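{- Let $q\in(0,1)$ and let $W=(w_{ij})_{i,j\ge1}$ have i.i.d. entries with $\mathrm P(w_{ij}=k)=(1-q)q^k$, $k\in\mathbb N$. For $m,n\ge1$ let $G(m,n)=\max_\Pi\sum_{(i,j)\in\Pi}w_{ij}$, the maximum over monotone lattice paths $\Pi$ from $(1,1)$ to $(m,n)$ with steps $(i,j)\to(i+1,j),(i,j+1)$. Let $b,c$ be positive integers and $\lambda=(\lambda_1\ge\cdots\ge\lambda_b\ge0)$ a partition with at most $b$ parts. Then $$\mathrm P(G(b,c)=\lambda_1,\ G(b-1,c)=\lambda_2,\dots,G(1,c)=\lambda_b)=\mathrm P_{g,b,c}(\lambda)=(1-q)^{bc}\,g_\lambda(\underbrace{q,\dots,q}_{c}),$$ where $\mathrm P_{g,b,c}(\lambda)$ is the probability that a plane partition distributed according to the $g$-measure with $q_1=\cdots=q_c=q$ has shape $\lambda$.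
   Context: $\mathrm{PP}(\infty,b,c)$ is the set of plane partitions (arrays $(\pi_{ij})_{i,j\ge1}$ of nonnegative integers, finitely many nonzero, weakly decreasing along rows and columns) with at most $b$ nonzero rows and entries at most $c$; the shape of $\pi$ is the partition with parts $|\{j:\pi_{ij}>0\}|$. $\mathrm{Des}(\pi)=\{(i,j):\pi_{ij}>\pi_{i+1,j}\}$. For $q_1,\dots,q_c\in(0,1)$ the $g$-measure is $\mathrm P_{g,b,c}(\pi)=Z_{b,c}^{ -1}\prod_{(i,j)\in\mathrm{Des}(\pi)}q_{\pi_{ij}}$ with normalizing constant $Z_{b,c}$. The dual Grothendieck polynomial is $g_\lambda(x_1,\dots,x_n)=\sum_T\prod_ix_i^{c_i(T)}$ over plane partitions $T$ of shape $\lambda$ with entries at most $n$, where $c_i(T)$ is the number of columns of $T$ containing $i$. -}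

module Defs where

open import Data.Nat using (ℕ; zero; suc; _+_; _∸_; _⊔_; _≡ᵇ_; _≤ᵇ_; _<ᵇ_)
open import Data.Integer as ℤ using (ℤ)
open import Data.Bool using (Bool; true; false; _∧_; if_then_else_)
open import Data.List using (List; []; _∷_; [_]; map; concatMap; upTo; length; filterᵇ; foldr; allFin)
open import Data.Nat.ListAction using (sum)
open import Data.Bool.ListAction using (and; any)
open import Data.Vec as V using (Vec)
open import Data.Fin using (Fin; toℕ)

count : {A : Set} → (A → Bool) → List A → ℕ
count p xs = length (filterᵇ p xs)

vecsUpTo : (n B : ℕ) → List (Vec ℕ n)
vecsUpTo zero    B = [ V.[] ]
vecsUpTo (suc n) B = concatMap (λ x → map (x V.∷_) (vecsUpTo n B)) (upTo (suc B))

Mat : ℕ → ℕ → Set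
Mat r w = Vec (Vec ℕ w) r

matsUpTo : (r w B : ℕ) → List (Mat r w)
matsUpTo zero    w B = [ V.[] ]
matsUpTo (suc r) w B = concatMap (λ x → map (x V.∷_) (matsUpTo r w B)) (vecsUpTo w B)

-- entry (i , j) of an array, 0-indexed, padded by 0 outside the array
-- (so an r×w array represents an infinite array with finitely many nonzero entries)
at : List ℕ → ℕ → ℕ
at []       _       = 0
at (x ∷ xs) zero    = x
at (x ∷ xs) (suc n) = at xs n

rowAt : List (List ℕ) → ℕ → List ℕ
rowAt []       _       = []
rowAt (x ∷ xs) zero    = x
rowAt (x ∷ xs) (suc n) = rowAt xs n

entry : {r w : ℕ} → Mat r w → ℕ → ℕ → ℕ
entry M i j = at (rowAt (V.toList (V.map V.toList M)) i) j

total : {r w : ℕ} → Mat r w → ℕ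
total M = sum (map (λ row → sum (V.toList row)) (V.toList M))

-- all Boolean lists of length n (true = step (i,j)→(i+1,j), false = (i,j)→(i,j+1))
allBools : ℕ → List (List Bool)
allBools zero    = [ [] ]
allBools (suc n) = concatMap (λ s → (true ∷ s) ∷ (false ∷ s) ∷ []) (allBools n)

countTrue : List Bool → ℕ
countTrue []           = 0
countTrue (true ∷ s)   = suc (countTrue s)
countTrue (false ∷ s)  = countTrue s

pathWeight : {r w : ℕ} → Mat r w → ℕ → ℕ → List Bool → ℕ
pathWeight M i j []          = entry M i j
pathWeight M i j (true ∷ s)  = entry M i j + pathWeight M (suc i) j s
pathWeight M i j (false ∷ s) = entry M i j + pathWeight M i (suc j) s

paths : ℕ → ℕ → List (List Bool)
paths m n = filterᵇ (λ s → countTrue s ≡ᵇ (m ∸ 1)) (allBools ((m ∸ 1) + (n ∸ 1)))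

-- G(m,n) = max over monotone paths Π from (1,1) to (m,n) of Σ_{(i,j)∈Π} w_ij
-- (paper's cell (i,j) is entry (i-1,j-1) here)
G : {r w : ℕ} → ℕ → ℕ → Mat r w → ℕ
G m n W = foldr _⊔_ 0 (map (pathWeight W 0 0) (paths m n))

isPPᵇ : {r w : ℕ} → Mat r w → Bool
isPPᵇ {r} {w} M =
  and (map (λ i → and (map (λ j →
        (entry M i (suc j) ≤ᵇ entry M i j) ∧ (entry M (suc i) j ≤ᵇ entry M i j)) (upTo w))) (upTo r))

rowLen : {r w : ℕ} → Mat r w → ℕ → ℕ
rowLen {r} {w} M i = count (λ j → 0 <ᵇ entry M i j) (upTo w)

hasShapeᵇ : {b w : ℕ} → Vec ℕ b → Mat b w → Bool
hasShapeᵇ {b} lam M = and (map (λ i → rowLen M (toℕ i) ≡ᵇ V.lookup lam i) (allFin b))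

desCount : {r w : ℕ} → Mat r w → ℕ
desCount {r} {w} M =
  sum (map (λ i → count (λ j → entry M (suc i) j <ᵇ entry M i j) (upTo w)) (upTo r))

colContent : {r w : ℕ} → ℕ → Mat r w → ℕ
colContent {r} {w} c T =
  sum (map (λ v → count (λ j → any (λ i → entry T i j ≡ᵇ suc v) (upTo r)) (upTo w)) (upTo c))

-- Formal power series in q with integer coefficients

Series : Set
Series = ℕ → ℤ

fromCount : (ℕ → ℕ) → Series
fromCount a k = ℤ.+ (a k)

convAux : Series → Series → ℕ → List ℕ → ℤ
convAux f g n []       = ℤ.+ 0
convAux f g n (i ∷ is) = f i ℤ.* g (n ∸ i) ℤ.+ convAux f g n is

_*ₛ_ : Series → Series → Series
(f *ₛ g) n = convAux f g n (upTo (suc n))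

oneₛ : Series
oneₛ zero    = ℤ.+ 1
oneₛ (suc _) = ℤ.+ 0

oneMinusQ : Series
oneMinusQ zero          = ℤ.+ 1
oneMinusQ (suc zero)    = ℤ.- (ℤ.+ 1)
oneMinusQ (suc (suc _)) = ℤ.+ 0

_^ₛ_ : Series → ℕ → Series
s ^ₛ zero  = oneₛ
s ^ₛ suc n = s *ₛ (s ^ₛ n)

-- Coefficient of q^k in Σ_{W ∈ ℕ^{b×c}, event} q^{|W|}:
-- number of b×c matrices W with |W| = k and G(b-i,c) = λ_{i+1} for i = 0..b-1.
lppCount : (b c : ℕ) → Vec ℕ b → ℕ → ℕ
lppCount b c lam k =
  count (λ W → (total W ≡ᵇ k) ∧ and (map (λ i → G (b ∸ toℕ i) c W ≡ᵇ V.lookup lam i) (allFin b)))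
        (matsUpTo b c k)

-- P(G(b,c)=λ_1, …, G(1,c)=λ_b) = Σ_{W in event} Π (1-q) q^{w_ij} = (1-q)^{bc} Σ q^{|W|}
probLPP : (b c : ℕ) → Vec ℕ b → Series
probLPP b c lam = (oneMinusQ ^ₛ (b Data.Nat.* c)) *ₛ fromCount (lppCount b c lam)

-- Coefficient of q^k in Z_{b,c} = Σ_{π ∈ PP(∞,b,c)} q^{|Des π|}.
-- A π with |Des π| = k has at most k nonzero columns, so it fits in a b×k box.
ZCount : (b c : ℕ) → ℕ → ℕ
ZCount b c k = count (λ π → isPPᵇ π ∧ (desCount π ≡ᵇ k)) (matsUpTo b k c)

Zbc : (b c : ℕ) → Series
Zbc b c = fromCount (ZCount b c)

-- Coefficient of q^k in Σ_{π ∈ PP(∞,b,c), shape π = λ} q^{|Des π|}  (numerator of P_{g,b,c}(λ))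
gNumCount : (b c : ℕ) → Vec ℕ b → ℕ → ℕ
gNumCount b c lam k = count (λ π → isPPᵇ π ∧ hasShapeᵇ lam π ∧ (desCount π ≡ᵇ k)) (matsUpTo b k c)

gNum : (b c : ℕ) → Vec ℕ b → Series
gNum b c lam = fromCount (gNumCount b c lam)

-- Coefficient of q^k in g_λ(q,…,q) (c variables): plane partitions T of shape λ with
-- entries ≤ c (they fit in a b × λ_1 box) and Σ_i c_i(T) = k.
gCount : (b c : ℕ) → Vec ℕ b → ℕ → ℕ
gCount b c lam k =
  count (λ T → isPPᵇ T ∧ hasShapeᵇ lam T ∧ (colContent c T ≡ᵇ k))
        (matsUpTo b (V.foldr (λ _ → ℕ) _⊔_ 0 lam) c)

gLam : (b c : ℕ) → Vec ℕ b → Series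
gLam b c lam = fromCount (gCount b c lam)

IsPartition : {b : ℕ} → Vec ℕ b → Set
IsPartition {b} lam = (i j : Fin b) → toℕ i Data.Nat.≤ toℕ j → V.lookup lam j Data.Nat.≤ V.lookup lam i

-- Write H(m,t) = G(m,t) for the last-passage times of W on the b × c box, with H = 0 on the top
-- and left borders. The recursion H(m,t) = max(H(m-1,t), H(m,t-1)) + w(m,t) identifies weight
-- matrices with tables H that increase along rows and columns, W being recovered as the increments
-- of H. Each row t ↦ H(m,t) is a partition with at most c parts read backwards, and its conjugate
-- is row b - m of a plane partition π with entries at most c. Row r of π then has length
-- H(b-r,c) = G(b-r,c), so the LPP event is the event that π has shape λ. The descents between two
-- consecutive rows of π are exactly as many as the total weight of the corresponding row of W, so
-- |Des π| = |W|; and for a plane partition Σᵢ cᵢ(π) = |Des π|, because the values in a column are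
-- its entries just above a strict descent. Hence summing q^|W| over the event gives both
-- Σ_{shape π = λ} q^|Des π| and g_λ(q,…,q), while summing over all W gives Z_{b,c} = (1 - q)^(-bc).

module Submission where

open import Algebra.Bundles using (CommutativeSemigroup; CommutativeMonoid)
import Algebra.Properties.CommutativeSemigroup as CommutativeSemigroupProperties
open import Algebra.Structures using (IsCommutativeSemiring)
open import Data.Bool using (Bool; true; false; _∧_; _∨_; if_then_else_)
open import Data.Bool.ListAction using (and; or)
open import Data.Bool.Properties using (T-≡; ¬-not; not-¬; ∧-conicalˡ; ∧-conicalʳ)
open import Data.Empty using (⊥-elim)
open import Data.Fin using (toℕ)
open import Data.Fin.Properties using (toℕ<n)
open import Data.Integer as ℤ using (ℤ)
import Data.Integer.Properties as ℤP
open import Data.List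
  using (List; []; _∷_; _++_; map; concatMap; cartesianProductWith; applyUpTo; upTo; allFin; foldr;
         replicate; filterᵇ; length)
open import Data.List.Membership.Propositional using (_∈_; find; lose)
open import Data.List.Membership.Propositional.Properties
  using (∈-map⁺; ∈-map⁻; ∈-filter⁺; ∈-filter⁻; ∈-upTo⁺; ∈-upTo⁻; ∈-cartesianProductWith⁺;
         ∈-cartesianProductWith⁻; ∈-concatMap⁺; ∈-concatMap⁻)
open import Data.List.Membership.Propositional.Properties.WithK using (unique∧set⇒bag)
open import Data.List.Properties using (length-map; length-replicate; length-++; map-upTo; map-cong; filter-++)
open import Data.List.Relation.Binary.BagAndSetEquality using (∼bag⇒↭)
open import Data.List.Relation.Binary.Permutation.Propositional.Properties using (↭-length)
open import Data.List.Relation.Unary.All as All using (All; []; _∷_)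
import Data.List.Relation.Unary.All.Properties as All
open import Data.List.Relation.Unary.AllPairs using ([]; _∷_)
open import Data.List.Relation.Unary.Any as Any using (Any; here; there)
open import Data.List.Relation.Unary.Unique.Propositional using (Unique)
import Data.List.Relation.Unary.Unique.Propositional.Properties as Unique
open import Data.Nat as ℕ using (ℕ; zero; suc; _+_; _*_; _∸_; _⊔_; _≤_; _<_; z≤n; s≤s; z<s; s<s; _<ᵇ_; _≤ᵇ_; _≡ᵇ_)
open import Data.Nat.ListAction using (sum)
open import Data.Nat.Properties
  using (+-*-isCommutativeSemiring; ⊔-commutativeSemigroup; module ≤-Reasoning; _<?_;
         ≤-refl; ≤-reflexive; ≤-trans; <-trans; <-≤-trans; ≤-pred; <⇒≤; <⇒≢; <⇒≱; ≤⇒≯; ≮⇒≥; n≤1+n; n<1+n;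
         m≤n⇒m≤1+n; m≤n⇒m<n∨m≡n; n≤0⇒n≡0; 0≢1+n; <⇒<ᵇ; <ᵇ⇒<; ≤⇒≤ᵇ; ≤ᵇ⇒≤; ≡⇒≡ᵇ; ≡ᵇ⇒≡;
         +-comm; +-assoc; +-identityʳ; +-suc; +-cancelʳ-≡; *-distribʳ-+; m≤m+n; m≤n+m;
         +-mono-≤; +-monoˡ-≤; +-monoʳ-≤; +-mono-≤-<; ⊔-comm; ⊔-assoc; ⊔-identityʳ; ⊔-lub; m≤m⊔n; m≤n⊔m;
         +-distribˡ-⊔; +-distribʳ-⊔; m∸n≤m; ∸-monoʳ-≤; m≤n⇒m∸n≡0; m<n⇒0<n∸m; m∸[m∸n]≡n; m∸n+n≡m;
         m+[n∸m]≡n; m+n∸m≡n; m+n∸n≡m; +-∸-assoc; ∸-+-assoc)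
open import Data.Product as Product using (_×_; _,_; proj₁; proj₂; ∃-syntax)
open import Data.Sum using (inj₁; inj₂)
import Data.Vec as V
open import Data.Vec using (Vec)
import Data.Vec.Properties as V
open import Function using (_∘_; id; flip; Equivalence; mk⇔)
open import Level using (0ℓ)
open import Relation.Binary.Bundles using (Setoid)
open import Relation.Binary.Definitions using (Reflexive; Transitive)
open import Relation.Binary.PropositionalEquality
import Relation.Binary.Reasoning.Setoid as SetoidReasoning
open import Relation.Nullary using (Dec; yes; no)
open import Relation.Nullary.Decidable using (T?)

open import Defs

open CommutativeSemigroupProperties ⊔-commutativeSemigroup using () renaming (interchange to ⊔-interchange)

-- Finite sums and counting

module FiniteSums {R : Set} {_⊕_ _⊛_ : R → R → R} {0# 1# : R}
                  (isCommutativeSemiring : IsCommutativeSemiring _≡_ _⊕_ _⊛_ 0# 1#) where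

  open IsCommutativeSemiring isCommutativeSemiring
    using (zeroˡ; zeroʳ; distribˡ; distribʳ)
    renaming (+-assoc to ⊕-assoc; +-comm to ⊕-comm; +-identityˡ to ⊕-identityˡ; +-identityʳ to ⊕-identityʳ;
              +-isCommutativeSemigroup to ⊕-isCommutativeSemigroup)

  private
    ⊕-commutativeSemigroup : CommutativeSemigroup 0ℓ 0ℓ
    ⊕-commutativeSemigroup = record { isCommutativeSemigroup = ⊕-isCommutativeSemigroup }

  open CommutativeSemigroupProperties ⊕-commutativeSemigroup using (interchange)
  open ≡-Reasoning

  ∑ : ℕ → (ℕ → R) → R
  ∑ zero    f = 0#
  ∑ (suc n) f = f 0 ⊕ ∑ n (f ∘ suc)

  syntax ∑ n (λ i → x) = ∑[ i < n ] x

  ∑-cong : ∀ n {f g : ℕ → R} → (∀ i → i < n → f i ≡ g i) → ∑ n f ≡ ∑ n g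
  ∑-cong zero    f≗g = refl
  ∑-cong (suc n) f≗g = cong₂ _⊕_ (f≗g 0 z<s) (∑-cong n (λ i i<n → f≗g (suc i) (s<s i<n)))

  ∑-zero : ∀ n {f : ℕ → R} → (∀ i → i < n → f i ≡ 0#) → ∑ n f ≡ 0#
  ∑-zero zero    f≗0 = refl
  ∑-zero (suc n) f≗0 =
    trans (cong₂ _⊕_ (f≗0 0 z<s) (∑-zero n (λ i i<n → f≗0 (suc i) (s<s i<n)))) (⊕-identityˡ 0#)

  ∑-distrib-⊕ : ∀ n (f g : ℕ → R) → ∑[ i < n ] (f i ⊕ g i) ≡ ∑ n f ⊕ ∑ n g
  ∑-distrib-⊕ zero    f g = sym (⊕-identityˡ 0#)
  ∑-distrib-⊕ (suc n) f g =
    trans (cong ((f 0 ⊕ g 0) ⊕_) (∑-distrib-⊕ n (f ∘ suc) (g ∘ suc))) (interchange (f 0) (g 0) _ _)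

  ∑-last : ∀ n (f : ℕ → R) → ∑ (suc n) f ≡ ∑ n f ⊕ f n
  ∑-last zero    f = trans (⊕-identityʳ (f 0)) (sym (⊕-identityˡ (f 0)))
  ∑-last (suc n) f = trans (cong (f 0 ⊕_) (∑-last n (f ∘ suc))) (sym (⊕-assoc (f 0) _ _))

  ∑-reverse : ∀ n (f : ℕ → R) → ∑[ i < n ] f (n ∸ suc i) ≡ ∑ n f
  ∑-reverse zero    f = refl
  ∑-reverse (suc n) f =
    trans (cong (f n ⊕_) (∑-reverse n f)) (trans (⊕-comm (f n) (∑ n f)) (sym (∑-last n f)))

  ∑-swap : ∀ m n (f : ℕ → ℕ → R) → ∑[ i < m ] ∑[ j < n ] f i j ≡ ∑[ j < n ] ∑[ i < m ] f i j
  ∑-swap zero    n f = sym (∑-zero n (λ _ _ → refl))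
  ∑-swap (suc m) n f = trans (cong (∑ n (f 0) ⊕_) (∑-swap m n (f ∘ suc))) (sym (∑-distrib-⊕ n (f 0) _))

  ∑-distribˡ : ∀ n (f : ℕ → R) x → x ⊛ ∑ n f ≡ ∑[ i < n ] (x ⊛ f i)
  ∑-distribˡ zero    f x = zeroʳ x
  ∑-distribˡ (suc n) f x = trans (distribˡ x (f 0) _) (cong ((x ⊛ f 0) ⊕_) (∑-distribˡ n (f ∘ suc) x))

  ∑-distribʳ : ∀ n (f : ℕ → R) x → ∑ n f ⊛ x ≡ ∑[ i < n ] (f i ⊛ x)
  ∑-distribʳ zero    f x = zeroˡ x
  ∑-distribʳ (suc n) f x = trans (distribʳ x (f 0) _) (cong ((f 0 ⊛ x) ⊕_) (∑-distribʳ n (f ∘ suc) x))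

  ∑-triangle : ∀ n (F : ℕ → ℕ → R) →
    ∑[ i < suc n ] ∑[ j < suc i ] F j i ≡ ∑[ j < suc n ] ∑[ l < suc (n ∸ j) ] F j (j + l)
  ∑-triangle zero    F = refl
  ∑-triangle (suc n) F = begin
    (F 0 0 ⊕ 0#) ⊕ (∑[ i < suc n ] (F 0 (suc i) ⊕ (∑[ j < suc i ] F (suc j) (suc i))))
      ≡⟨ cong₂ _⊕_ (⊕-identityʳ (F 0 0)) (∑-distrib-⊕ (suc n) (F 0 ∘ suc) (λ i → ∑[ j < suc i ] F (suc j) (suc i))) ⟩
    F 0 0 ⊕ (column₀ ⊕ (∑[ i < suc n ] ∑[ j < suc i ] F (suc j) (suc i)))
      ≡⟨ cong (λ x → F 0 0 ⊕ (column₀ ⊕ x)) (∑-triangle n (λ j i → F (suc j) (suc i))) ⟩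
    F 0 0 ⊕ (column₀ ⊕ rest)
      ≡⟨ sym (⊕-assoc (F 0 0) column₀ rest) ⟩
    (F 0 0 ⊕ column₀) ⊕ rest ∎
    where
    column₀ rest : R
    column₀ = ∑[ i < suc n ] F 0 (suc i)
    rest    = ∑[ j < suc n ] ∑[ l < suc (n ∸ j) ] F (suc j) (suc (j + l))

open FiniteSums +-*-isCommutativeSemiring

∑-mono-≤ : ∀ n {f g : ℕ → ℕ} → (∀ i → i < n → f i ≤ g i) → ∑ n f ≤ ∑ n g
∑-mono-≤ zero    f≤g = z≤n
∑-mono-≤ (suc n) f≤g = +-mono-≤ (f≤g 0 z<s) (∑-mono-≤ n (λ i i<n → f≤g (suc i) (s<s i<n)))

term≤∑ : ∀ n (f : ℕ → ℕ) i → i < n → f i ≤ ∑ n f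
term≤∑ (suc n) f zero    _         = m≤m+n (f 0) _
term≤∑ (suc n) f (suc i) (s<s i<n) = ≤-trans (term≤∑ n (f ∘ suc) i i<n) (m≤n+m _ (f 0))

module _ {_∼_ : ℕ → ℕ → Set} (∼-refl : Reflexive _∼_) (∼-trans : Transitive _∼_) where

  stepwise : ∀ (f : ℕ → ℕ) n → (∀ t → t < n → f t ∼ f (suc t)) → ∀ {s t} → s ≤ t → t ≤ n → f s ∼ f t
  stepwise f n step {t = zero}  z≤n   _     = ∼-refl
  stepwise f n step {t = suc t} s≤1+t 1+t≤n with m≤n⇒m<n∨m≡n s≤1+t
  ... | inj₂ refl      = ∼-refl
  ... | inj₁ (s≤s s≤t) = ∼-trans (stepwise f n step s≤t (<⇒≤ 1+t≤n)) (step t 1+t≤n)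

stepwise-mono : ∀ (f : ℕ → ℕ) n → (∀ t → t < n → f t ≤ f (suc t)) → ∀ {s t} → s ≤ t → t ≤ n → f s ≤ f t
stepwise-mono = stepwise {_≤_} ≤-refl ≤-trans

stepwise-antitone : ∀ (f : ℕ → ℕ) n → (∀ t → t < n → f (suc t) ≤ f t) → ∀ {s t} → s ≤ t → t ≤ n → f t ≤ f s
stepwise-antitone = stepwise {flip _≤_} ≤-refl (flip ≤-trans)

𝟙 : Bool → ℕ
𝟙 true  = 1
𝟙 false = 0

count< : ℕ → (ℕ → Bool) → ℕ
count< n p = ∑[ i < n ] 𝟙 (p i)

syntax count< n (λ i → b) = #[ i < n ] b

<ᵇ-intro : ∀ {m n} → m < n → (m <ᵇ n) ≡ true
<ᵇ-intro = Equivalence.to T-≡ ∘ <⇒<ᵇ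

<ᵇ-elim : ∀ {m n} → (m <ᵇ n) ≡ true → m < n
<ᵇ-elim {m} {n} = <ᵇ⇒< m n ∘ Equivalence.from T-≡

≮ᵇ-intro : ∀ {m n} → n ≤ m → (m <ᵇ n) ≡ false
≮ᵇ-intro n≤m = ¬-not (≤⇒≯ n≤m ∘ <ᵇ-elim)

≤ᵇ-intro : ∀ {m n} → m ≤ n → (m ≤ᵇ n) ≡ true
≤ᵇ-intro = Equivalence.to T-≡ ∘ ≤⇒≤ᵇ

≤ᵇ-elim : ∀ {m n} → (m ≤ᵇ n) ≡ true → m ≤ n
≤ᵇ-elim {m} {n} = ≤ᵇ⇒≤ m n ∘ Equivalence.from T-≡

≰ᵇ-intro : ∀ {m n} → n < m → (m ≤ᵇ n) ≡ false
≰ᵇ-intro n<m = ¬-not (<⇒≱ n<m ∘ ≤ᵇ-elim)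

≡ᵇ-intro : ∀ {m n} → m ≡ n → (m ≡ᵇ n) ≡ true
≡ᵇ-intro {m} {n} = Equivalence.to T-≡ ∘ ≡⇒≡ᵇ m n

≡ᵇ-elim : ∀ {m n} → (m ≡ᵇ n) ≡ true → m ≡ n
≡ᵇ-elim {m} {n} = ≡ᵇ⇒≡ m n ∘ Equivalence.from T-≡

≢ᵇ-intro : ∀ {m n} → m ≢ n → (m ≡ᵇ n) ≡ false
≢ᵇ-intro m≢n = ¬-not (m≢n ∘ ≡ᵇ-elim)

≡ᵇ-sym : ∀ m n → (m ≡ᵇ n) ≡ (n ≡ᵇ m)
≡ᵇ-sym zero    zero    = refl
≡ᵇ-sym zero    (suc n) = refl
≡ᵇ-sym (suc m) zero    = refl
≡ᵇ-sym (suc m) (suc n) = ≡ᵇ-sym m n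

<ᵇ-⊔ : ∀ {j m} n → m ≤ j → (j <ᵇ m ⊔ n) ≡ (j <ᵇ n)
<ᵇ-⊔ {j} {m} n m≤j with j <? n
... | yes j<n = trans (<ᵇ-intro (<-≤-trans j<n (m≤n⊔m m n))) (sym (<ᵇ-intro j<n))
... | no  j≮n = trans (≮ᵇ-intro (⊔-lub m≤j (≮⇒≥ j≮n))) (sym (≮ᵇ-intro (≮⇒≥ j≮n)))

𝟙-<ᵇ-𝟙 : ∀ {p q} → (p ≡ true → q ≡ true) → 𝟙 (𝟙 p <ᵇ 𝟙 q) + 𝟙 p ≡ 𝟙 q
𝟙-<ᵇ-𝟙 {false} {false} _   = refl
𝟙-<ᵇ-𝟙 {false} {true}  _   = refl
𝟙-<ᵇ-𝟙 {true}  {q}     p⇒q rewrite p⇒q refl = refl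

𝟙-∨-disjoint : ∀ {x y} → (x ≡ true → y ≡ false) → 𝟙 (x ∨ y) ≡ 𝟙 x + 𝟙 y
𝟙-∨-disjoint {false} _     = refl
𝟙-∨-disjoint {true}  x⇒¬y rewrite x⇒¬y refl = refl

∨-absorbˡ : ∀ {x y} → (x ≡ true → y ≡ true) → x ∨ y ≡ y
∨-absorbˡ {false} _   = refl
∨-absorbˡ {true}  x⇒y = sym (x⇒y refl)

count<-cong : ∀ n {p q : ℕ → Bool} → (∀ i → i < n → p i ≡ q i) → count< n p ≡ count< n q
count<-cong n p≗q = ∑-cong n (λ i i<n → cong 𝟙 (p≗q i i<n))

count<-all : ∀ n {p : ℕ → Bool} → (∀ i → i < n → p i ≡ true) → count< n p ≡ n
count<-all zero    _ = refl
count<-all (suc n) all rewrite all 0 z<s = cong suc (count<-all n (λ i i<n → all (suc i) (s<s i<n)))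

count<-none : ∀ n {p : ℕ → Bool} → (∀ i → i < n → p i ≡ false) → count< n p ≡ 0
count<-none n none = ∑-zero n (λ i i<n → cong 𝟙 (none i i<n))

count<-≤ : ∀ n (p : ℕ → Bool) → count< n p ≤ n
count<-≤ zero    p = z≤n
count<-≤ (suc n) p = +-mono-≤ (𝟙≤1 (p 0)) (count<-≤ n (p ∘ suc))
  where
  𝟙≤1 : ∀ b → 𝟙 b ≤ 1
  𝟙≤1 true  = ≤-refl
  𝟙≤1 false = z≤n

𝟙-mono : ∀ {x y} → (x ≡ true → y ≡ true) → 𝟙 x ≤ 𝟙 y
𝟙-mono {false} x⇒y = z≤n
𝟙-mono {true}  x⇒y rewrite x⇒y refl = ≤-refl

count<-mono : ∀ n {p q : ℕ → Bool} → (∀ i → i < n → p i ≡ true → q i ≡ true) → count< n p ≤ count< n q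
count<-mono n p⇒q = ∑-mono-≤ n (λ i i<n → 𝟙-mono (p⇒q i i<n))

count<-strict : ∀ n {p q : ℕ → Bool} → (∀ i → i < n → p i ≡ true → q i ≡ true) →
  ∀ s → s < n → q s ≡ true → p s ≡ false → count< n p < count< n q
count<-strict (suc n) p⇒q zero    _         qs ps rewrite qs | ps =
  s≤s (count<-mono n (λ i i<n → p⇒q (suc i) (s<s i<n)))
count<-strict (suc n) p⇒q (suc s) (s<s s<n) qs ps =
  +-mono-≤-< (𝟙-mono (p⇒q 0 z<s)) (count<-strict n (λ i i<n → p⇒q (suc i) (s<s i<n)) s s<n qs ps)

count<-initial : ∀ n h → h ≤ n → #[ j < n ] (j <ᵇ h) ≡ h
count<-initial n       zero    _         = count<-none n (λ _ _ → refl)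
count<-initial (suc n) (suc h) (s≤s h≤n) = cong suc (count<-initial n h h≤n)

count<-downClosed : ∀ K {p : ℕ → Bool} → (∀ j → p (suc j) ≡ true → p j ≡ true) → (∀ j → K ≤ j → p j ≡ false) →
  ∀ j → (j <ᵇ count< K p) ≡ p j
count<-downClosed zero    closed vanish j = sym (vanish j z≤n)
count<-downClosed (suc K) {p} closed vanish j with p 0 in p0
... | false = trans (cong (j <ᵇ_) (count<-none K (λ i _ → nowhere (suc i)))) (sym (nowhere j))
  where
  nowhere : ∀ i → p i ≡ false
  nowhere i = ¬-not (λ pi → not-¬ p0 (everywhere-below i pi))
    where
    everywhere-below : ∀ i → p i ≡ true → p 0 ≡ true
    everywhere-below zero    holds = holds
    everywhere-below (suc i) holds = everywhere-below i (closed i holds)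
count<-downClosed (suc K) closed vanish zero    | true = sym p0
count<-downClosed (suc K) closed vanish (suc j) | true =
  count<-downClosed K (closed ∘ suc) (λ i K≤i → vanish (suc i) (s≤s K≤i)) j

count<-upClosed : ∀ c {p : ℕ → Bool} → (∀ t → suc t < c → p t ≡ true → p (suc t) ≡ true) →
  ∀ s → s < c → ((c ∸ s) ≤ᵇ count< c p) ≡ p s
count<-upClosed (suc c) {p} closed s s<c with p 0 in p0
... | true = trans (cong ((suc c ∸ s) ≤ᵇ_) (cong suc (count<-all c (λ i i<c → everywhere (suc i) (s<s i<c)))))
                   (trans (≤ᵇ-intro (m∸n≤m (suc c) s)) (sym (everywhere s s<c)))
  where
  everywhere : ∀ i → i < suc c → p i ≡ true
  everywhere zero    _   = p0
  everywhere (suc i) i<c = closed i i<c (everywhere i (<-trans (n<1+n i) i<c))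
... | false with s
...   | zero   = trans (≰ᵇ-intro (s≤s (count<-≤ c _))) (sym p0)
...   | suc s′ = count<-upClosed c (λ t t<c → closed (suc t) (s<s t<c)) s′ (≤-pred s<c)

count<-threshold : ∀ c x → x ≤ c → #[ t < c ] ((c ∸ t) ≤ᵇ x) ≡ x
count<-threshold c x x≤c = begin
  #[ t < c ] ((c ∸ t) ≤ᵇ x)                   ≡⟨ ∑-reverse c (λ t → 𝟙 ((c ∸ t) ≤ᵇ x)) ⟨
  ∑[ i < c ] 𝟙 ((c ∸ (c ∸ suc i)) ≤ᵇ x)       ≡⟨ ∑-cong c (λ i i<c → cong (λ k → 𝟙 (k ≤ᵇ x)) (m∸[m∸n]≡n i<c)) ⟩
  #[ i < c ] (i <ᵇ x)                         ≡⟨ count<-initial c x x≤c ⟩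
  x                                           ∎
  where open ≡-Reasoning

count<-≡ᵇ : ∀ n x → x < n → #[ v < n ] (x ≡ᵇ v) ≡ 1
count<-≡ᵇ (suc n) zero    _         = cong suc (count<-none n (λ _ _ → refl))
count<-≡ᵇ (suc n) (suc x) (s<s x<n) = count<-≡ᵇ n x x<n

or-applyUpTo⁻ : ∀ (p : ℕ → Bool) n → or (applyUpTo p n) ≡ true → ∃[ i ] (i < n × p i ≡ true)
or-applyUpTo⁻ p (suc n) any with p 0 in p0
... | true  = 0 , z<s , p0
... | false with i , i<n , pi ← or-applyUpTo⁻ (p ∘ suc) n any = suc i , s<s i<n , pi

sum-applyUpTo : ∀ (f : ℕ → ℕ) n → sum (applyUpTo f n) ≡ ∑ n f
sum-applyUpTo f zero    = refl
sum-applyUpTo f (suc n) = cong (f 0 +_) (sum-applyUpTo (f ∘ suc) n)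

count-∷ : ∀ {A : Set} (p : A → Bool) x xs → count p (x ∷ xs) ≡ 𝟙 (p x) + count p xs
count-∷ p x xs with p x
... | true  = refl
... | false = refl

count-applyUpTo : ∀ {A : Set} (p : A → Bool) (f : ℕ → A) n → count p (applyUpTo f n) ≡ #[ i < n ] p (f i)
count-applyUpTo p f zero    = refl
count-applyUpTo p f (suc n) =
  trans (count-∷ p (f 0) _) (cong (𝟙 (p (f 0)) +_) (count-applyUpTo p (f ∘ suc) n))

and-upTo⁻ : ∀ (p : ℕ → Bool) n → and (map p (upTo n)) ≡ true → ∀ i → i < n → p i ≡ true
and-upTo⁻ p n all rewrite map-upTo p n = go p n all
  where
  go : ∀ (p : ℕ → Bool) n → and (applyUpTo p n) ≡ true → ∀ i → i < n → p i ≡ true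
  go p (suc n) all zero    _         = ∧-conicalˡ _ _ all
  go p (suc n) all (suc i) (s<s i<n) = go (p ∘ suc) n (∧-conicalʳ _ _ all) i i<n

and-upTo⁺ : ∀ (p : ℕ → Bool) n → (∀ i → i < n → p i ≡ true) → and (map p (upTo n)) ≡ true
and-upTo⁺ p n all rewrite map-upTo p n = go p n all
  where
  go : ∀ (p : ℕ → Bool) n → (∀ i → i < n → p i ≡ true) → and (applyUpTo p n) ≡ true
  go p zero    all = refl
  go p (suc n) all = cong₂ _∧_ (all 0 z<s) (go (p ∘ suc) n (λ i i<n → all (suc i) (s<s i<n)))

count-++ : ∀ {A : Set} (p : A → Bool) xs ys → count p (xs ++ ys) ≡ count p xs + count p ys
count-++ p xs ys = trans (cong length (filter-++ (T? ∘ p) xs ys)) (length-++ (filterᵇ p xs))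

count-map : ∀ {A B : Set} (p : B → Bool) (f : A → B) xs → count p (map f xs) ≡ count (p ∘ f) xs
count-map p f []       = refl
count-map p f (x ∷ xs) =
  trans (count-∷ p (f x) _) (trans (cong (𝟙 (p (f x)) +_) (count-map p f xs)) (sym (count-∷ (p ∘ f) x xs)))

count-concatMap : ∀ {A B : Set} (p : B → Bool) (h : A → List B) xs →
  count p (concatMap h xs) ≡ sum (map (λ x → count p (h x)) xs)
count-concatMap p h []       = refl
count-concatMap p h (x ∷ xs) = trans (count-++ p (h x) _) (cong (count p (h x) +_) (count-concatMap p h xs))

count-cong : ∀ {A : Set} {p q : A → Bool} → (∀ x → p x ≡ q x) → ∀ xs → count p xs ≡ count q xs
count-cong p≗q []       = refl
count-cong {p = p} {q} p≗q (x ∷ xs) =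
  trans (count-∷ p x xs) (trans (cong₂ _+_ (cong 𝟙 (p≗q x)) (count-cong p≗q xs)) (sym (count-∷ q x xs)))

count-none : ∀ {A : Set} {p : A → Bool} → (∀ x → p x ≡ false) → ∀ xs → count p xs ≡ 0
count-none none xs = trans (count-cong none xs) (go xs)
  where
  go : ∀ xs → count (λ _ → false) xs ≡ 0
  go []       = refl
  go (_ ∷ xs) = go xs

count-bijection : ∀ {A B : Set} {p : A → Bool} {q : B → Bool} {xs : List A} {ys : List B}
  (f : A → B) (g : B → A) → Unique xs → Unique ys →
  (∀ {x} → x ∈ xs → p x ≡ true → f x ∈ ys × q (f x) ≡ true × g (f x) ≡ x) →
  (∀ {y} → y ∈ ys → q y ≡ true → g y ∈ xs × p (g y) ≡ true × f (g y) ≡ y) →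
  count p xs ≡ count q ys
count-bijection {p = p} {q} {xs} {ys} f g xs! ys! forth back =
  trans (sym (length-map f (filterᵇ p xs))) (↭-length (∼bag⇒↭ (unique∧set⇒bag image! filtered! (mk⇔ to from))))
  where
  filter! : ∀ {C : Set} {r : C → Bool} {zs} → Unique zs → Unique (filterᵇ r zs)
  filter! {r = r} = Unique.filter⁺ (T? ∘ r)

  ∈-filter : ∀ {C : Set} {r : C → Bool} {z zs} → z ∈ filterᵇ r zs → z ∈ zs × r z ≡ true
  ∈-filter {r = r} z∈ = Product.map₂ (Equivalence.to T-≡) (∈-filter⁻ (T? ∘ r) z∈)

  map-unique : ∀ zs → All (λ z → g (f z) ≡ z) zs → Unique zs → Unique (map f zs)
  map-unique []       []             []          = []
  map-unique (z ∷ zs) (gfz ∷ retract) (z∉ ∷ zs!) =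
    All.map⁺ (All.zipWith (λ (gfy , z≢y) fz≡fy → z≢y (trans (sym gfz) (trans (cong g fz≡fy) gfy)))
                          (retract , z∉))
    ∷ map-unique zs retract zs!

  image! : Unique (map f (filterᵇ p xs))
  image! = map-unique _ (All.tabulate (λ z∈ → let (x∈ , px) = ∈-filter z∈ in proj₂ (proj₂ (forth x∈ px))))
                        (filter! xs!)

  filtered! : Unique (filterᵇ q ys)
  filtered! = filter! ys!

  to : ∀ {y} → y ∈ map f (filterᵇ p xs) → y ∈ filterᵇ q ys
  to y∈ with ∈-map⁻ f y∈
  ... | x , x∈ , refl with ∈-filter x∈
  ...   | x∈xs , px with forth x∈xs px
  ...     | fx∈ , qfx , _ = ∈-filter⁺ (T? ∘ q) fx∈ (Equivalence.from T-≡ qfx)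

  from : ∀ {y} → y ∈ filterᵇ q ys → y ∈ map f (filterᵇ p xs)
  from y∈ with ∈-filter y∈
  ... | y∈ys , qy with back y∈ys qy
  ...   | gy∈ , pgy , fgy = subst (_∈ map f (filterᵇ p xs)) fgy (∈-map⁺ f (∈-filter⁺ (T? ∘ p) gy∈ (Equivalence.from T-≡ pgy)))

∑-delta : ∀ n a (F : ℕ → ℕ) → (n ≤ a → F a ≡ 0) → ∑[ s < n ] (𝟙 (s ≡ᵇ a) * F s) ≡ F a
∑-delta zero    a       F outside = sym (outside z≤n)
∑-delta (suc n) zero    F outside = trans (cong₂ _+_ (+-identityʳ (F 0)) (∑-zero n (λ _ _ → refl))) (+-identityʳ (F 0))
∑-delta (suc n) (suc a) F outside = ∑-delta n a (F ∘ suc) (outside ∘ s≤s)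

sum-map-fibres : ∀ {A : Set} (α : A → ℕ) (F : ℕ → ℕ) k → (∀ s → k < s → F s ≡ 0) → ∀ xs →
  sum (map (F ∘ α) xs) ≡ ∑[ s < suc k ] (count (λ x → s ≡ᵇ α x) xs * F s)
sum-map-fibres α F k vanish []       = sym (∑-zero (suc k) (λ _ _ → refl))
sum-map-fibres α F k vanish (x ∷ xs) = begin
  F (α x) + sum (map (F ∘ α) xs)
    ≡⟨ cong₂ _+_ (sym (∑-delta (suc k) (α x) F (vanish (α x)))) (sum-map-fibres α F k vanish xs) ⟩
  ∑[ s < suc k ] (𝟙 (s ≡ᵇ α x) * F s) + ∑[ s < suc k ] (count (λ x → s ≡ᵇ α x) xs * F s)
    ≡⟨ ∑-distrib-⊕ (suc k) (λ s → 𝟙 (s ≡ᵇ α x) * F s) (λ s → count (λ x → s ≡ᵇ α x) xs * F s) ⟨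
  ∑[ s < suc k ] (𝟙 (s ≡ᵇ α x) * F s + count (λ x → s ≡ᵇ α x) xs * F s)
    ≡⟨ ∑-cong (suc k) (λ s _ → trans (cong (_* F s) (count-∷ (λ x → s ≡ᵇ α x) x xs))
                                       (*-distribʳ-+ (F s) (𝟙 (s ≡ᵇ α x)) (count (λ x → s ≡ᵇ α x) xs))) ⟨
  ∑[ s < suc k ] (count (λ x → s ≡ᵇ α x) (x ∷ xs) * F s) ∎
  where open ≡-Reasoning

+-≡ᵇ : ∀ s t k → s ≤ k → (s + t ≡ᵇ k) ≡ (t ≡ᵇ k ∸ s)
+-≡ᵇ zero    t k       _         = refl
+-≡ᵇ (suc s) t (suc k) (s≤s s≤k) = +-≡ᵇ s t k s≤k

count-∷-product : ∀ {A : Set} {n} (γ : Vec A (suc n) → ℕ) (α : A → ℕ) (β : Vec A n → ℕ) →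
  (∀ x v → γ (x V.∷ v) ≡ α x + β v) → ∀ xs vs k →
  count (λ v → γ v ≡ᵇ k) (concatMap (λ x → map (x V.∷_) vs) xs)
    ≡ ∑[ s < suc k ] (count (λ x → s ≡ᵇ α x) xs * count (λ v → β v ≡ᵇ k ∸ s) vs)
count-∷-product γ α β split xs vs k = begin
  count (λ v → γ v ≡ᵇ k) (concatMap (λ x → map (x V.∷_) vs) xs)
    ≡⟨ count-concatMap _ _ xs ⟩
  sum (map (λ x → count (λ v → γ v ≡ᵇ k) (map (x V.∷_) vs)) xs)
    ≡⟨ cong sum (map-cong (λ x → trans (count-map _ (x V.∷_) vs) (count-cong (λ v → cong (_≡ᵇ k) (split x v)) vs)) xs) ⟩
  sum (map (F ∘ α) xs)
    ≡⟨ sum-map-fibres α F k (λ s k<s → count-none (λ v → ≢ᵇ-intro (<⇒≢ (<-≤-trans k<s (m≤m+n s (β v))) ∘ sym)) vs) xs ⟩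
  ∑[ s < suc k ] (count (λ x → s ≡ᵇ α x) xs * F s)
    ≡⟨ ∑-cong (suc k) (λ s s≤k → cong (count (λ x → s ≡ᵇ α x) xs *_) (count-cong (λ v → +-≡ᵇ s (β v) k (≤-pred s≤k)) vs)) ⟩
  ∑[ s < suc k ] (count (λ x → s ≡ᵇ α x) xs * count (λ v → β v ≡ᵇ k ∸ s) vs) ∎
  where
  open ≡-Reasoning
  F : ℕ → ℕ
  F s = count (λ v → s + β v ≡ᵇ k) vs

-- Bounded arrays and their enumerations

concatMap-map : ∀ {A B C : Set} (f : A → B → C) xs ys →
  concatMap (λ x → map (f x) ys) xs ≡ cartesianProductWith f xs ys
concatMap-map f []       ys = refl
concatMap-map f (x ∷ xs) ys = cong (map (f x) ys ++_) (concatMap-map f xs ys)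

module _ {A : Set} {n : ℕ} (xs : List A) (vs : List (Vec A n)) where

  ∷-product-unique : Unique xs → Unique vs → Unique (concatMap (λ x → map (x V.∷_) vs) xs)
  ∷-product-unique xs! vs! rewrite concatMap-map V._∷_ xs vs =
    Unique.cartesianProductWith⁺ V._∷_ V.∷-injective xs! vs!

  ∈-∷-product⁺ : ∀ {x v} → x ∈ xs → v ∈ vs → x V.∷ v ∈ concatMap (λ x → map (x V.∷_) vs) xs
  ∈-∷-product⁺ x∈ v∈ rewrite concatMap-map V._∷_ xs vs = ∈-cartesianProductWith⁺ V._∷_ x∈ v∈

  ∈-∷-product⁻ : ∀ {x v} → x V.∷ v ∈ concatMap (λ x → map (x V.∷_) vs) xs → x ∈ xs × v ∈ vs
  ∈-∷-product⁻ xv∈ rewrite concatMap-map V._∷_ xs vs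
    with _ , _ , x∈ , v∈ , xv≡ ← ∈-cartesianProductWith⁻ V._∷_ xs vs xv∈
    with refl , refl ← V.∷-injective xv≡ = x∈ , v∈

vecEntry : ∀ {w} → Vec ℕ w → ℕ → ℕ
vecEntry v j = at (V.toList v) j

vecsUpTo-unique : ∀ n B → Unique (vecsUpTo n B)
vecsUpTo-unique zero    B = All.[] ∷ []
vecsUpTo-unique (suc n) B = ∷-product-unique (upTo (suc B)) (vecsUpTo n B) (Unique.upTo⁺ (suc B)) (vecsUpTo-unique n B)

∈-vecsUpTo⁺ : ∀ {n} B (v : Vec ℕ n) → (∀ j → vecEntry v j ≤ B) → v ∈ vecsUpTo n B
∈-vecsUpTo⁺ B V.[]       bounded = here refl
∈-vecsUpTo⁺ B (x V.∷ v) bounded =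
  ∈-∷-product⁺ (upTo (suc B)) (vecsUpTo _ B) (∈-upTo⁺ (s≤s (bounded 0))) (∈-vecsUpTo⁺ B v (bounded ∘ suc))

∈-vecsUpTo⁻ : ∀ {n} B (v : Vec ℕ n) → v ∈ vecsUpTo n B → ∀ j → vecEntry v j ≤ B
∈-vecsUpTo⁻ B V.[]       _  j       = z≤n
∈-vecsUpTo⁻ B (x V.∷ v) v∈ zero    = ≤-pred (∈-upTo⁻ (proj₁ (∈-∷-product⁻ (upTo (suc B)) (vecsUpTo _ B) v∈)))
∈-vecsUpTo⁻ B (x V.∷ v) v∈ (suc j) = ∈-vecsUpTo⁻ B v (proj₂ (∈-∷-product⁻ (upTo (suc B)) (vecsUpTo _ B) v∈)) j

matsUpTo-unique : ∀ r w B → Unique (matsUpTo r w B)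
matsUpTo-unique zero    w B = All.[] ∷ []
matsUpTo-unique (suc r) w B = ∷-product-unique (vecsUpTo w B) (matsUpTo r w B) (vecsUpTo-unique w B) (matsUpTo-unique r w B)

∈-matsUpTo⁺ : ∀ {r w} B (M : Mat r w) → (∀ i j → entry M i j ≤ B) → M ∈ matsUpTo r w B
∈-matsUpTo⁺ B V.[]       bounded = here refl
∈-matsUpTo⁺ B (x V.∷ M) bounded =
  ∈-∷-product⁺ (vecsUpTo _ B) (matsUpTo _ _ B) (∈-vecsUpTo⁺ B x (bounded 0)) (∈-matsUpTo⁺ B M (bounded ∘ suc))

∈-matsUpTo⁻ : ∀ {r w} B (M : Mat r w) → M ∈ matsUpTo r w B → ∀ i j → entry M i j ≤ B
∈-matsUpTo⁻ B V.[]       _  i       j = z≤n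
∈-matsUpTo⁻ B (x V.∷ M) M∈ zero    j = ∈-vecsUpTo⁻ B x (proj₁ (∈-∷-product⁻ (vecsUpTo _ B) (matsUpTo _ _ B) M∈)) j
∈-matsUpTo⁻ B (x V.∷ M) M∈ (suc i) j = ∈-matsUpTo⁻ B M (proj₂ (∈-∷-product⁻ (vecsUpTo _ B) (matsUpTo _ _ B) M∈)) i j

Array : Set
Array = ℕ → ℕ → ℕ

tabulateVec : ∀ w → (ℕ → ℕ) → Vec ℕ w
tabulateVec zero    f = V.[]
tabulateVec (suc w) f = f 0 V.∷ tabulateVec w (f ∘ suc)

tabulateMat : ∀ r w → Array → Mat r w
tabulateMat zero    w F = V.[]
tabulateMat (suc r) w F = tabulateVec w (F 0) V.∷ tabulateMat r w (F ∘ suc)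

vecEntry-tabulateVec : ∀ w f j → j < w → vecEntry (tabulateVec w f) j ≡ f j
vecEntry-tabulateVec (suc w) f zero    _         = refl
vecEntry-tabulateVec (suc w) f (suc j) (s<s j<w) = vecEntry-tabulateVec w (f ∘ suc) j j<w

entry-tabulateMat : ∀ r w F i j → i < r → j < w → entry (tabulateMat r w F) i j ≡ F i j
entry-tabulateMat (suc r) w F zero    j _         j<w = vecEntry-tabulateVec w (F 0) j j<w
entry-tabulateMat (suc r) w F (suc i) j (s<s i<r) j<w = entry-tabulateMat r w (F ∘ suc) i j i<r j<w

vecEntry-outside : ∀ {w} (v : Vec ℕ w) j → w ≤ j → vecEntry v j ≡ 0
vecEntry-outside V.[]       j       _         = refl
vecEntry-outside (x V.∷ v) (suc j) (s≤s w≤j) = vecEntry-outside v j w≤j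

entry-below : ∀ {r w} (M : Mat r w) i j → r ≤ i → entry M i j ≡ 0
entry-below V.[]       i       j _         = refl
entry-below (x V.∷ M) (suc i) j (s≤s r≤i) = entry-below M i j r≤i

entry-right : ∀ {r w} (M : Mat r w) i j → w ≤ j → entry M i j ≡ 0
entry-right V.[]       i       j _   = refl
entry-right (x V.∷ M) zero    j w≤j = vecEntry-outside x j w≤j
entry-right (x V.∷ M) (suc i) j w≤j = entry-right M i j w≤j

entry-tabulateMat-supported : ∀ r w F → (∀ i j → r ≤ i → F i j ≡ 0) → (∀ i j → w ≤ j → F i j ≡ 0) →
  ∀ i j → entry (tabulateMat r w F) i j ≡ F i j
entry-tabulateMat-supported r w F below right i j with i <? r | j <? w
... | yes i<r | yes j<w = entry-tabulateMat r w F i j i<r j<w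
... | no  i≮r | _       = trans (entry-below (tabulateMat r w F) i j (≮⇒≥ i≮r)) (sym (below i j (≮⇒≥ i≮r)))
... | yes _   | no  j≮w = trans (entry-right (tabulateMat r w F) i j (≮⇒≥ j≮w)) (sym (right i j (≮⇒≥ j≮w)))

Vec-ext : ∀ {w} (u v : Vec ℕ w) → (∀ j → j < w → vecEntry u j ≡ vecEntry v j) → u ≡ v
Vec-ext V.[]       V.[]       _   = refl
Vec-ext (x V.∷ u) (y V.∷ v) u≗v = cong₂ V._∷_ (u≗v 0 z<s) (Vec-ext u v (λ j j<w → u≗v (suc j) (s<s j<w)))

Mat-ext : ∀ {r w} (M N : Mat r w) → (∀ i j → i < r → j < w → entry M i j ≡ entry N i j) → M ≡ N
Mat-ext V.[]       V.[]       _   = refl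
Mat-ext (x V.∷ M) (y V.∷ N) M≗N =
  cong₂ V._∷_ (Vec-ext x y (λ j j<w → M≗N 0 j z<s j<w)) (Mat-ext M N (λ i j i<r j<w → M≗N (suc i) j (s<s i<r) j<w))

sum-toList : ∀ {w} (v : Vec ℕ w) → sum (V.toList v) ≡ ∑ w (vecEntry v)
sum-toList V.[]       = refl
sum-toList (x V.∷ v) = cong (x +_) (sum-toList v)

total≡∑ : ∀ {r w} (M : Mat r w) → total M ≡ ∑[ i < r ] ∑[ j < w ] entry M i j
total≡∑ V.[]       = refl
total≡∑ (x V.∷ M) = cong₂ _+_ (sum-toList x) (total≡∑ M)

≡0⇒≤ : ∀ {m n} → m ≡ 0 → m ≤ n
≡0⇒≤ refl = z≤n

entry≤total : ∀ {r w} (M : Mat r w) i j → entry M i j ≤ total M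
entry≤total {r} {w} M i j with i <? r | j <? w
... | yes i<r | yes j<w = begin
  entry M i j                        ≤⟨ term≤∑ w (entry M i) j j<w ⟩
  ∑[ j < w ] entry M i j             ≤⟨ term≤∑ r (λ i → ∑[ j < w ] entry M i j) i i<r ⟩
  ∑[ i < r ] ∑[ j < w ] entry M i j  ≡⟨ total≡∑ M ⟨
  total M                            ∎
  where open ≤-Reasoning
... | no  i≮r | _       = ≡0⇒≤ (entry-below M i j (≮⇒≥ i≮r))
... | yes _   | no  j≮w = ≡0⇒≤ (entry-right M i j (≮⇒≥ j≮w))

vecEntry≤sum : ∀ {n} (v : Vec ℕ n) j → vecEntry v j ≤ sum (V.toList v)
vecEntry≤sum V.[]       j       = z≤n
vecEntry≤sum (x V.∷ v) zero    = m≤m+n x _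
vecEntry≤sum (x V.∷ v) (suc j) = ≤-trans (vecEntry≤sum v j) (m≤n+m _ x)

-- Last passage percolation

maxWhere : {A : Set} → (A → Bool) → (A → ℕ) → List A → ℕ
maxWhere p f xs = foldr _⊔_ 0 (map f (filterᵇ p xs))

module _ {A : Set} (p : A → Bool) where

  maxWhere-∷ : ∀ f x xs → maxWhere p f (x ∷ xs) ≡ (if p x then f x else 0) ⊔ maxWhere p f xs
  maxWhere-∷ f x xs with p x
  ... | true  = refl
  ... | false = refl

  maxWhere-none : ∀ f {xs} → All (λ x → p x ≡ false) xs → maxWhere p f xs ≡ 0
  maxWhere-none f []                 = refl
  maxWhere-none f (_∷_ {x} px none) rewrite px = maxWhere-none f none

  -- The extra ⊔ (c + y) keeps this true when no element satisfies p, where maxWhere is 0, not c + 0.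
  maxWhere-+-⊔ : ∀ c f xs y → maxWhere p (λ x → c + f x) xs ⊔ (c + y) ≡ c + (maxWhere p f xs ⊔ y)
  maxWhere-+-⊔ c f []       y = refl
  maxWhere-+-⊔ c f (x ∷ xs) y with p x
  ... | false = maxWhere-+-⊔ c f xs y
  ... | true  = begin
    ((c + f x) ⊔ maxWhere p (λ x → c + f x) xs) ⊔ (c + y) ≡⟨ ⊔-assoc (c + f x) _ _ ⟩
    (c + f x) ⊔ (maxWhere p (λ x → c + f x) xs ⊔ (c + y)) ≡⟨ cong ((c + f x) ⊔_) (maxWhere-+-⊔ c f xs y) ⟩
    (c + f x) ⊔ (c + (maxWhere p f xs ⊔ y))               ≡⟨ +-distribˡ-⊔ c (f x) _ ⟨
    c + (f x ⊔ (maxWhere p f xs ⊔ y))                     ≡⟨ cong (c +_) (⊔-assoc (f x) _ y) ⟨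
    c + ((f x ⊔ maxWhere p f xs) ⊔ y)                     ∎
    where open ≡-Reasoning

  maxWhere-+ : ∀ c f {xs} → Any (λ x → p x ≡ true) xs → maxWhere p (λ x → c + f x) xs ≡ c + maxWhere p f xs
  maxWhere-+ c f {x ∷ xs} (here px) rewrite px =
    trans (⊔-comm (c + f x) _) (trans (maxWhere-+-⊔ c f xs (f x)) (cong (c +_) (⊔-comm _ (f x))))
  maxWhere-+ c f {x ∷ xs} (there any) with p x
  ... | true  = trans (cong ((c + f x) ⊔_) (maxWhere-+ c f any)) (sym (+-distribˡ-⊔ c (f x) _))
  ... | false = maxWhere-+ c f any

branch : List Bool → List (List Bool)
branch s = (true ∷ s) ∷ (false ∷ s) ∷ []

maxWhere-allBools-suc : ∀ (p : List Bool → Bool) f n →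
  maxWhere p f (allBools (suc n)) ≡
  maxWhere (p ∘ (true ∷_)) (f ∘ (true ∷_)) (allBools n) ⊔ maxWhere (p ∘ (false ∷_)) (f ∘ (false ∷_)) (allBools n)
maxWhere-allBools-suc p f n = go (allBools n)
  where
  go : ∀ L → maxWhere p f (concatMap branch L) ≡
             maxWhere (p ∘ (true ∷_)) (f ∘ (true ∷_)) L ⊔ maxWhere (p ∘ (false ∷_)) (f ∘ (false ∷_)) L
  go []      = refl
  go (s ∷ L) = begin
    maxWhere p f ((true ∷ s) ∷ (false ∷ s) ∷ rest)
      ≡⟨ maxWhere-∷ p f (true ∷ s) _ ⟩
    down ⊔ maxWhere p f ((false ∷ s) ∷ rest)
      ≡⟨ cong (down ⊔_) (maxWhere-∷ p f (false ∷ s) rest) ⟩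
    down ⊔ (right ⊔ maxWhere p f rest)
      ≡⟨ cong (λ m → down ⊔ (right ⊔ m)) (go L) ⟩
    down ⊔ (right ⊔ (downs L ⊔ rights L))
      ≡⟨ ⊔-assoc down right _ ⟨
    (down ⊔ right) ⊔ (downs L ⊔ rights L)
      ≡⟨ ⊔-interchange down right (downs L) (rights L) ⟩
    (down ⊔ downs L) ⊔ (right ⊔ rights L)
      ≡⟨ cong₂ _⊔_ (maxWhere-∷ (p ∘ (true ∷_)) (f ∘ (true ∷_)) s L) (maxWhere-∷ (p ∘ (false ∷_)) (f ∘ (false ∷_)) s L) ⟨
    downs (s ∷ L) ⊔ rights (s ∷ L) ∎
    where
    open ≡-Reasoning
    rest : List (List Bool)
    rest = concatMap branch L
    down right : ℕ
    down  = if p (true ∷ s) then f (true ∷ s) else 0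
    right = if p (false ∷ s) then f (false ∷ s) else 0
    downs rights : List (List Bool) → ℕ
    downs  = maxWhere (p ∘ (true ∷_)) (f ∘ (true ∷_))
    rights = maxWhere (p ∘ (false ∷_)) (f ∘ (false ∷_))

∈-allBools : ∀ s → s ∈ allBools (length s)
∈-allBools []      = here refl
∈-allBools (b ∷ s) = ∈-concatMap⁺ branch (Any.map (λ { refl → step b }) (∈-allBools s))
  where
  step : ∀ b → b ∷ s ∈ branch s
  step true  = here refl
  step false = there (here refl)

length-allBools : ∀ n {s} → s ∈ allBools n → length s ≡ n
length-allBools zero    (here refl) = refl
length-allBools (suc n) s∈ with _ , s′∈ , s∈step ← find (∈-concatMap⁻ branch {xs = allBools n} s∈)
  with s∈step
... | here refl         = cong suc (length-allBools n s′∈)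
... | there (here refl) = cong suc (length-allBools n s′∈)

countTrue≤length : ∀ s → countTrue s ≤ length s
countTrue≤length []          = z≤n
countTrue≤length (true ∷ s)  = s≤s (countTrue≤length s)
countTrue≤length (false ∷ s) = m≤n⇒m≤1+n (countTrue≤length s)

staircase : ℕ → ℕ → List Bool
staircase zero    d = replicate d false
staircase (suc a) d = true ∷ staircase a d

paths-exist : ∀ a d → Any (λ s → (countTrue s ≡ᵇ a) ≡ true) (allBools (a + d))
paths-exist a d = lose (subst (λ n → staircase a d ∈ allBools n) (length-staircase a) (∈-allBools (staircase a d)))
                       (≡ᵇ-intro (countTrue-staircase a))
  where
  length-staircase : ∀ a → length (staircase a d) ≡ a + d
  length-staircase zero    = length-replicate d
  length-staircase (suc a) = cong suc (length-staircase a)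
  countTrue-staircase : ∀ a → countTrue (staircase a d) ≡ a
  countTrue-staircase (suc a) = cong suc (countTrue-staircase a)
  countTrue-staircase zero    = falses d
    where
    falses : ∀ d → countTrue (replicate d false) ≡ 0
    falses zero    = refl
    falses (suc d) = falses d

no-paths : ∀ a n → n < a → All (λ s → (countTrue s ≡ᵇ a) ≡ false) (allBools n)
no-paths a n n<a = All.tabulate λ {s} s∈ →
  ≢ᵇ-intro (λ eq → <⇒≱ n<a (subst (_≤ n) eq (subst (countTrue s ≤_) (length-allBools n s∈) (countTrue≤length s))))

+-⊔-interchange : ∀ e z a b c d → e + (((a ⊔ b) + z) ⊔ ((c ⊔ d) + z)) ≡ ((e + (a ⊔ c)) ⊔ (e + (b ⊔ d))) + z
+-⊔-interchange e z a b c d = begin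
  e + (((a ⊔ b) + z) ⊔ ((c ⊔ d) + z))   ≡⟨ cong (e +_) (+-distribʳ-⊔ z (a ⊔ b) (c ⊔ d)) ⟨
  e + (((a ⊔ b) ⊔ (c ⊔ d)) + z)         ≡⟨ cong (λ x → e + (x + z)) (⊔-interchange a b c d) ⟩
  e + (((a ⊔ c) ⊔ (b ⊔ d)) + z)         ≡⟨ +-assoc e _ z ⟨
  (e + ((a ⊔ c) ⊔ (b ⊔ d))) + z         ≡⟨ cong (_+ z) (+-distribˡ-⊔ e (a ⊔ c) (b ⊔ d)) ⟩
  ((e + (a ⊔ c)) ⊔ (e + (b ⊔ d))) + z   ∎
  where open ≡-Reasoning

module LastPassage {r w : ℕ} (W : Mat r w) where

  lpp : Array
  lpp zero    t       = 0
  lpp (suc m) zero    = 0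
  lpp (suc m) (suc t) = (lpp m (suc t) ⊔ lpp (suc m) t) + entry W m t

  -- Defs enumerates paths by their first step, so path maxima unfold the recursion lppFrom at the
  -- starting corner; lppFrom-last turns it into the recursion lpp at the final corner.
  lppFrom : ℕ → ℕ → Array
  lppFrom i j zero    t       = 0
  lppFrom i j (suc m) zero    = 0
  lppFrom i j (suc m) (suc t) = entry W i j + (lppFrom (suc i) j m (suc t) ⊔ lppFrom i (suc j) (suc m) t)

  lppFrom-last : ∀ i j m t →
    lppFrom i j (suc m) (suc t) ≡ (lppFrom i j m (suc t) ⊔ lppFrom i j (suc m) t) + entry W (i + m) (j + t)
  lppFrom-last i j zero zero = begin
    entry W i j + 0          ≡⟨ +-identityʳ _ ⟩
    entry W i j              ≡⟨ cong₂ (entry W) (+-identityʳ i) (+-identityʳ j) ⟨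
    entry W (i + 0) (j + 0)  ∎
    where open ≡-Reasoning
  lppFrom-last i j zero (suc t) = begin
    entry W i j + lppFrom i (suc j) 1 (suc t)
      ≡⟨ cong (entry W i j +_) (lppFrom-last i (suc j) zero t) ⟩
    entry W i j + (lppFrom i (suc j) 1 t + entry W (i + 0) (suc j + t))
      ≡⟨ +-assoc (entry W i j) _ _ ⟨
    (entry W i j + lppFrom i (suc j) 1 t) + entry W (i + 0) (suc j + t)
      ≡⟨ cong (λ k → (entry W i j + lppFrom i (suc j) 1 t) + entry W (i + 0) k) (+-suc j t) ⟨
    (entry W i j + lppFrom i (suc j) 1 t) + entry W (i + 0) (j + suc t) ∎
    where open ≡-Reasoning
  lppFrom-last i j (suc m) zero = begin
    entry W i j + (lppFrom (suc i) j (suc m) 1 ⊔ 0)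
      ≡⟨ cong (entry W i j +_) (⊔-identityʳ _) ⟩
    entry W i j + lppFrom (suc i) j (suc m) 1
      ≡⟨ cong (entry W i j +_) (lppFrom-last (suc i) j m zero) ⟩
    entry W i j + ((lppFrom (suc i) j m 1 ⊔ 0) + entry W (suc i + m) (j + 0))
      ≡⟨ +-assoc (entry W i j) _ _ ⟨
    (entry W i j + (lppFrom (suc i) j m 1 ⊔ 0)) + entry W (suc i + m) (j + 0)
      ≡⟨ cong₂ _+_ (⊔-identityʳ _) (cong (λ k → entry W k (j + 0)) (+-suc i m)) ⟨
    ((entry W i j + (lppFrom (suc i) j m 1 ⊔ 0)) ⊔ 0) + entry W (i + suc m) (j + 0) ∎
    where open ≡-Reasoning
  lppFrom-last i j (suc m) (suc t) =
    trans (cong₂ (λ x y → e + (x ⊔ y)) down right) (+-⊔-interchange e z D₁ D₂ R₁ R₂)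
    where
    e z D₁ D₂ R₁ R₂ : ℕ
    e  = entry W i j
    z  = entry W (i + suc m) (j + suc t)
    D₁ = lppFrom (suc i) j m (suc (suc t))
    D₂ = lppFrom (suc i) j (suc m) (suc t)
    R₁ = lppFrom i (suc j) (suc m) (suc t)
    R₂ = lppFrom i (suc j) (suc (suc m)) t
    down : lppFrom (suc i) j (suc m) (suc (suc t)) ≡ (D₁ ⊔ D₂) + z
    down = trans (lppFrom-last (suc i) j m (suc t)) (cong (λ k → (D₁ ⊔ D₂) + entry W k (j + suc t)) (sym (+-suc i m)))
    right : lppFrom i (suc j) (suc (suc m)) (suc t) ≡ (R₁ ⊔ R₂) + z
    right = trans (lppFrom-last i (suc j) (suc m) t) (cong (λ k → (R₁ ⊔ R₂) + entry W (i + suc m) k) (sym (+-suc j t)))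

  lpp≡lppFrom : ∀ m t → lpp m t ≡ lppFrom 0 0 m t
  lpp≡lppFrom zero    t       = refl
  lpp≡lppFrom (suc m) zero    = refl
  lpp≡lppFrom (suc m) (suc t) =
    trans (cong₂ (λ x y → (x ⊔ y) + entry W m t) (lpp≡lppFrom m (suc t)) (lpp≡lppFrom (suc m) t))
          (sym (lppFrom-last 0 0 m t))

  maxPaths : ℕ → ℕ → ℕ → ℕ → ℕ
  maxPaths i j a n = maxWhere (λ s → countTrue s ≡ᵇ a) (pathWeight W i j) (allBools n)

  maxPaths≡lppFrom : ∀ i j a d → maxPaths i j a (a + d) ≡ lppFrom i j (suc a) (suc d)
  maxPaths≡lppFrom i j zero zero = trans (⊔-identityʳ _) (sym (+-identityʳ _))
  maxPaths≡lppFrom i j zero (suc d) = begin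
    maxPaths i j 0 (suc d)
      ≡⟨ maxWhere-allBools-suc _ _ d ⟩
    maxWhere (λ s → countTrue (true ∷ s) ≡ᵇ 0) _ (allBools d) ⊔ maxWhere _ (λ s → e + pathWeight W i (suc j) s) (allBools d)
      ≡⟨ cong (_⊔ maxWhere (λ s → countTrue s ≡ᵇ 0) (λ s → e + pathWeight W i (suc j) s) (allBools d))
              (maxWhere-none _ _ (All.universal (λ _ → refl) (allBools d))) ⟩
    maxWhere (λ s → countTrue s ≡ᵇ 0) (λ s → e + pathWeight W i (suc j) s) (allBools d)
      ≡⟨ maxWhere-+ _ e (pathWeight W i (suc j)) (paths-exist 0 d) ⟩
    e + maxPaths i (suc j) 0 d
      ≡⟨ cong (e +_) (maxPaths≡lppFrom i (suc j) 0 d) ⟩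
    e + lppFrom i (suc j) 1 (suc d) ∎
    where
    open ≡-Reasoning
    e : ℕ
    e = entry W i j
  maxPaths≡lppFrom i j (suc a) zero = begin
    maxPaths i j (suc a) (suc (a + 0))
      ≡⟨ maxWhere-allBools-suc _ _ (a + 0) ⟩
    maxWhere _ (λ s → e + pathWeight W (suc i) j s) (allBools (a + 0)) ⊔ maxWhere (λ s → countTrue s ≡ᵇ suc a) _ (allBools (a + 0))
      ≡⟨ cong₂ _⊔_ (maxWhere-+ _ e (pathWeight W (suc i) j) (paths-exist a 0))
                   (maxWhere-none _ _ (no-paths (suc a) (a + 0) (s≤s (≤-reflexive (+-identityʳ a))))) ⟩
    (e + maxPaths (suc i) j a (a + 0)) ⊔ 0
      ≡⟨ ⊔-identityʳ _ ⟩
    e + maxPaths (suc i) j a (a + 0)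
      ≡⟨ cong (e +_) (maxPaths≡lppFrom (suc i) j a 0) ⟩
    e + lppFrom (suc i) j (suc a) 1
      ≡⟨ cong (e +_) (⊔-identityʳ _) ⟨
    e + (lppFrom (suc i) j (suc a) 1 ⊔ 0) ∎
    where
    open ≡-Reasoning
    e : ℕ
    e = entry W i j
  maxPaths≡lppFrom i j (suc a) (suc d) = begin
    maxPaths i j (suc a) (suc (a + suc d))
      ≡⟨ maxWhere-allBools-suc _ _ (a + suc d) ⟩
    maxWhere _ (λ s → e + pathWeight W (suc i) j s) (allBools (a + suc d))
      ⊔ maxWhere _ (λ s → e + pathWeight W i (suc j) s) (allBools (a + suc d))
      ≡⟨ cong₂ _⊔_ (maxWhere-+ _ e (pathWeight W (suc i) j) (paths-exist a (suc d)))
                   (maxWhere-+ _ e (pathWeight W i (suc j))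
                      (subst (λ n → Any (λ s → (countTrue s ≡ᵇ suc a) ≡ true) (allBools n)) (sym (+-suc a d))
                             (paths-exist (suc a) d))) ⟩
    (e + maxPaths (suc i) j a (a + suc d)) ⊔ (e + maxPaths i (suc j) (suc a) (a + suc d))
      ≡⟨ +-distribˡ-⊔ e _ _ ⟨
    e + (maxPaths (suc i) j a (a + suc d) ⊔ maxPaths i (suc j) (suc a) (a + suc d))
      ≡⟨ cong (λ n → e + (maxPaths (suc i) j a (a + suc d) ⊔ maxPaths i (suc j) (suc a) n)) (+-suc a d) ⟩
    e + (maxPaths (suc i) j a (a + suc d) ⊔ maxPaths i (suc j) (suc a) (suc a + d))
      ≡⟨ cong₂ (λ x y → e + (x ⊔ y)) (maxPaths≡lppFrom (suc i) j a (suc d)) (maxPaths≡lppFrom i (suc j) (suc a) d) ⟩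
    e + (lppFrom (suc i) j (suc a) (suc (suc d)) ⊔ lppFrom i (suc j) (suc (suc a)) (suc d)) ∎
    where
    open ≡-Reasoning
    e : ℕ
    e = entry W i j

  G≡lpp : ∀ {m t} → 1 ≤ m → 1 ≤ t → G m t W ≡ lpp m t
  G≡lpp {suc m} {suc t} _ _ = trans (maxPaths≡lppFrom 0 0 m t) (sym (lpp≡lppFrom (suc m) (suc t)))

  lpp-left-zero : ∀ m → lpp m 0 ≡ 0
  lpp-left-zero zero    = refl
  lpp-left-zero (suc m) = refl

  lpp-mono-down : ∀ m t → lpp m t ≤ lpp (suc m) t
  lpp-mono-down m zero    = ≤-reflexive (lpp-left-zero m)
  lpp-mono-down m (suc t) = ≤-trans (m≤m⊔n _ (lpp (suc m) t)) (m≤m+n _ (entry W m t))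

  lpp-mono-right : ∀ m t → lpp m t ≤ lpp m (suc t)
  lpp-mono-right zero    t = z≤n
  lpp-mono-right (suc m) t = ≤-trans (m≤n⊔m (lpp m (suc t)) _) (m≤m+n _ (entry W m t))

  lpp≤∑ : ∀ m t → lpp m t ≤ ∑[ i < m ] ∑[ j < t ] entry W i j
  lpp≤∑ zero    t       = z≤n
  lpp≤∑ (suc m) zero    = z≤n
  lpp≤∑ (suc m) (suc t) = begin
    (lpp m (suc t) ⊔ lpp (suc m) t) + e m t         ≡⟨ +-distribʳ-⊔ (e m t) (lpp m (suc t)) _ ⟩
    (lpp m (suc t) + e m t) ⊔ (lpp (suc m) t + e m t)
      ≤⟨ ⊔-lub (≤-trans (+-monoˡ-≤ (e m t) (lpp≤∑ m (suc t))) extend-down)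
               (≤-trans (+-monoˡ-≤ (e m t) (lpp≤∑ (suc m) t)) extend-right) ⟩
    S (suc m) (suc t)                               ∎
    where
    open ≤-Reasoning
    e : Array
    e = entry W
    S : ℕ → ℕ → ℕ
    S m t = ∑[ i < m ] ∑[ j < t ] e i j
    extend-down : S m (suc t) + e m t ≤ S (suc m) (suc t)
    extend-down = begin
      S m (suc t) + e m t                   ≤⟨ +-monoʳ-≤ (S m (suc t)) (term≤∑ (suc t) (e m) t ≤-refl) ⟩
      S m (suc t) + ∑[ j < suc t ] e m j    ≡⟨ ∑-last m (λ i → ∑[ j < suc t ] e i j) ⟨
      S (suc m) (suc t)                     ∎
    extend-right : S (suc m) t + e m t ≤ S (suc m) (suc t)
    extend-right = begin
      S (suc m) t + e m t                                      ≤⟨ +-monoʳ-≤ (S (suc m) t) (term≤∑ (suc m) (λ i → e i t) m ≤-refl) ⟩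
      S (suc m) t + ∑[ i < suc m ] e i t                       ≡⟨ ∑-distrib-⊕ (suc m) (λ i → ∑[ j < t ] e i j) (λ i → e i t) ⟨
      ∑[ i < suc m ] ((∑[ j < t ] e i j) + e i t)              ≡⟨ ∑-cong (suc m) (λ i _ → ∑-last t (e i)) ⟨
      S (suc m) (suc t)                                        ∎

  lpp≤total : lpp r w ≤ total W
  lpp≤total = ≤-trans (lpp≤∑ r w) (≤-reflexive (sym (total≡∑ W)))

-- Descents of conjugate partitions

+-∸-cancel : ∀ {x y lo hi} → lo ≤ hi → x + lo ≡ y + hi → x ≡ y + (hi ∸ lo)
+-∸-cancel {x} {y} {lo} {hi} lo≤hi eq = +-cancelʳ-≡ lo x (y + (hi ∸ lo)) (begin
  x + lo                ≡⟨ eq ⟩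
  y + hi                ≡⟨ cong (y +_) (m∸n+n≡m lo≤hi) ⟨
  y + ((hi ∸ lo) + lo)  ≡⟨ +-assoc y (hi ∸ lo) lo ⟨
  (y + (hi ∸ lo)) + lo  ∎)
  where open ≡-Reasoning

module ConjugateDescents (c K : ℕ) (α β : ℕ → ℕ)
  (β≤α : ∀ t → t ≤ c → β t ≤ α t)
  (α-mono : ∀ t → t < c → α t ≤ α (suc t))
  (β-mono : ∀ t → t < c → β t ≤ β (suc t))
  (α-zero : α 0 ≡ 0)
  (α≤K : α c ≤ K) where

  conjα conjβ : ℕ → ℕ → ℕ
  conjα n j = #[ t < n ] (j <ᵇ α (suc t))
  conjβ n j = #[ t < n ] (j <ᵇ β (suc t))

  conjβ≤conjα : ∀ n j → n ≤ c → conjβ n j ≤ conjα n j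
  conjβ≤conjα n j n≤c = count<-mono n (λ t t<n j<β → <ᵇ-intro (<-≤-trans (<ᵇ-elim j<β) (β≤α (suc t) (≤-trans t<n n≤c))))

  conjα-vanish : ∀ n j → n ≤ c → α n ≤ j → conjα n j ≡ 0
  conjα-vanish n j n≤c αn≤j =
    count<-none n (λ t t<n → ≮ᵇ-intro (≤-trans (stepwise-mono α c α-mono t<n n≤c) αn≤j))

  conjβ<conjα : ∀ n j → n ≤ c → j < α n → β n ≤ j → conjβ n j < conjα n j
  conjβ<conjα zero    j _   j<α0 _    = ⊥-elim (<⇒≱ j<α0 (subst (_≤ j) (sym α-zero) z≤n))
  conjβ<conjα (suc n) j n<c j<αn βn≤j =
    count<-strict (suc n) (λ t t<n j<β → <ᵇ-intro (<-≤-trans (<ᵇ-elim j<β) (β≤α (suc t) (≤-trans t<n n<c))))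
                  n ≤-refl (<ᵇ-intro j<αn) (≮ᵇ-intro βn≤j)

  -- A descent at j between the conjugate rows means β t ≤ j < α t for some t ≤ n. Going from n to
  -- n + 1 adds the interval [β (n+1), α (n+1)), whose part not already covered is [α n ⊔ β (n+1), α (n+1)).
  descent-step : ∀ n j → n < c →
    𝟙 (conjβ (suc n) j <ᵇ conjα (suc n) j) + 𝟙 (j <ᵇ α n ⊔ β (suc n)) ≡ 𝟙 (conjβ n j <ᵇ conjα n j) + 𝟙 (j <ᵇ α (suc n))
  descent-step n j n<c
    rewrite ∑-last n (λ t → 𝟙 (j <ᵇ α (suc t))) | ∑-last n (λ t → 𝟙 (j <ᵇ β (suc t))) with j <? α n
  ... | yes j<αn
    rewrite <ᵇ-intro {j} {α (suc n)} (<-≤-trans j<αn (α-mono n n<c))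
          | <ᵇ-intro {j} {α n ⊔ β (suc n)} (<-≤-trans j<αn (m≤m⊔n (α n) (β (suc n))))
          = cong (_+ 1) (shift (j <? β (suc n)))
    where
    shift : Dec (j < β (suc n)) →
      𝟙 ((conjβ n j + 𝟙 (j <ᵇ β (suc n))) <ᵇ (conjα n j + 1)) ≡ 𝟙 (conjβ n j <ᵇ conjα n j)
    shift (yes j<β) rewrite <ᵇ-intro j<β | +-comm (conjβ n j) 1 | +-comm (conjα n j) 1 = refl
    shift (no  j≮β) rewrite ≮ᵇ-intro (≮⇒≥ j≮β) | +-identityʳ (conjβ n j) | +-comm (conjα n j) 1
      | <ᵇ-intro (s≤s (conjβ≤conjα n j (<⇒≤ n<c)))
      | <ᵇ-intro (conjβ<conjα n j (<⇒≤ n<c) j<αn (≤-trans (β-mono n n<c) (≮⇒≥ j≮β))) = refl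
  ... | no  j≮αn
    rewrite conjα-vanish n j (<⇒≤ n<c) (≮⇒≥ j≮αn)
          | n≤0⇒n≡0 (subst (conjβ n j ≤_) (conjα-vanish n j (<⇒≤ n<c) (≮⇒≥ j≮αn)) (conjβ≤conjα n j (<⇒≤ n<c)))
          | <ᵇ-⊔ (β (suc n)) (≮⇒≥ j≮αn)
          = 𝟙-<ᵇ-𝟙 (λ j<β → <ᵇ-intro (<-≤-trans (<ᵇ-elim j<β) (β≤α (suc n) n<c)))

  descents-conj : ∀ n → n ≤ c → #[ j < K ] (conjβ n j <ᵇ conjα n j) ≡ ∑[ t < n ] (α (suc t) ∸ (β (suc t) ⊔ α t))
  descents-conj zero    _   = count<-none K (λ _ _ → refl)
  descents-conj (suc n) n<c = begin
    #[ j < K ] (conjβ (suc n) j <ᵇ conjα (suc n) j)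
      ≡⟨ +-∸-cancel lo≤hi balance ⟩
    ∑[ t < n ] (α (suc t) ∸ (β (suc t) ⊔ α t)) + (hi ∸ lo)
      ≡⟨ cong (λ x → ∑[ t < n ] (α (suc t) ∸ (β (suc t) ⊔ α t)) + (hi ∸ x)) (⊔-comm (α n) (β (suc n))) ⟩
    ∑[ t < n ] (α (suc t) ∸ (β (suc t) ⊔ α t)) + (α (suc n) ∸ (β (suc n) ⊔ α n))
      ≡⟨ ∑-last n (λ t → α (suc t) ∸ (β (suc t) ⊔ α t)) ⟨
    ∑[ t < suc n ] (α (suc t) ∸ (β (suc t) ⊔ α t)) ∎
    where
    open ≡-Reasoning
    lo hi : ℕ
    lo = α n ⊔ β (suc n)
    hi = α (suc n)
    lo≤hi : lo ≤ hi
    lo≤hi = ⊔-lub (α-mono n n<c) (β≤α (suc n) n<c)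
    hi≤K : hi ≤ K
    hi≤K = ≤-trans (stepwise-mono α c α-mono n<c ≤-refl) α≤K
    lo≤K : lo ≤ K
    lo≤K = ≤-trans lo≤hi hi≤K
    balance : #[ j < K ] (conjβ (suc n) j <ᵇ conjα (suc n) j) + lo ≡ ∑[ t < n ] (α (suc t) ∸ (β (suc t) ⊔ α t)) + hi
    balance = begin
      #[ j < K ] (conjβ (suc n) j <ᵇ conjα (suc n) j) + lo
        ≡⟨ cong (#[ j < K ] (conjβ (suc n) j <ᵇ conjα (suc n) j) +_) (count<-initial K lo lo≤K) ⟨
      #[ j < K ] (conjβ (suc n) j <ᵇ conjα (suc n) j) + #[ j < K ] (j <ᵇ lo)
        ≡⟨ ∑-distrib-⊕ K _ _ ⟨
      ∑[ j < K ] (𝟙 (conjβ (suc n) j <ᵇ conjα (suc n) j) + 𝟙 (j <ᵇ lo))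
        ≡⟨ ∑-cong K (λ j _ → descent-step n j n<c) ⟩
      ∑[ j < K ] (𝟙 (conjβ n j <ᵇ conjα n j) + 𝟙 (j <ᵇ hi))
        ≡⟨ ∑-distrib-⊕ K _ _ ⟩
      #[ j < K ] (conjβ n j <ᵇ conjα n j) + #[ j < K ] (j <ᵇ hi)
        ≡⟨ cong₂ _+_ (descents-conj n (<⇒≤ n<c)) (count<-initial K hi hi≤K) ⟩
      ∑[ t < n ] (α (suc t) ∸ (β (suc t) ⊔ α t)) + hi ∎

-- The positive values of a weakly decreasing column ending in zeros are its entries a i with a (suc i) < a i.
values≡descents : ∀ c n (a : ℕ → ℕ) → (∀ i → a (suc i) ≤ a i) → (∀ i → a i ≤ c) → (∀ i → n ≤ i → a i ≡ 0) →
  #[ v < c ] or (applyUpTo (λ i → a i ≡ᵇ suc v) n) ≡ #[ i < n ] (a (suc i) <ᵇ a i)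
values≡descents c zero    a antitone ≤c vanish = count<-none c (λ _ _ → refl)
values≡descents c (suc n) a antitone ≤c vanish with m≤n⇒m<n∨m≡n (antitone 0)
... | inj₁ a₁<a₀ = begin
  #[ v < c ] ((a 0 ≡ᵇ suc v) ∨ later v)
    ≡⟨ ∑-cong c (λ v _ → 𝟙-∨-disjoint (new v)) ⟩
  ∑[ v < c ] (𝟙 (a 0 ≡ᵇ suc v) + 𝟙 (later v))
    ≡⟨ ∑-distrib-⊕ c _ _ ⟩
  #[ v < c ] (a 0 ≡ᵇ suc v) + #[ v < c ] later v
    ≡⟨ cong₂ _+_ (top-once (a 0) refl)
                 (values≡descents c n (a ∘ suc) (antitone ∘ suc) (≤c ∘ suc) (λ i n≤i → vanish (suc i) (s≤s n≤i))) ⟩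
  1 + #[ i < n ] (a (suc (suc i)) <ᵇ a (suc i))
    ≡⟨ cong (_+ #[ i < n ] (a (suc (suc i)) <ᵇ a (suc i))) (cong 𝟙 (<ᵇ-intro a₁<a₀)) ⟨
  #[ i < suc n ] (a (suc i) <ᵇ a i) ∎
  where
  open ≡-Reasoning
  later : ℕ → Bool
  later v = or (applyUpTo (λ i → a (suc i) ≡ᵇ suc v) n)
  new : ∀ v → (a 0 ≡ᵇ suc v) ≡ true → later v ≡ false
  new v a₀≡ = ¬-not λ seen → let i , _ , a≡ = or-applyUpTo⁻ _ n seen in
    <⇒≱ a₁<a₀ (subst (_≤ a 1) (trans (≡ᵇ-elim a≡) (sym (≡ᵇ-elim a₀≡)))
                     (stepwise-antitone (a ∘ suc) i (λ t _ → antitone (suc t)) z≤n ≤-refl))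
  top-once : ∀ x → x ≡ a 0 → #[ v < c ] (x ≡ᵇ suc v) ≡ 1
  top-once zero    x≡a₀ = ⊥-elim (<⇒≱ a₁<a₀ (subst (_≤ a 1) x≡a₀ z≤n))
  top-once (suc x) x≡a₀ = count<-≡ᵇ c x (subst (_≤ c) (sym x≡a₀) (≤c 0))
... | inj₂ a₁≡a₀ = begin
  #[ v < c ] ((a 0 ≡ᵇ suc v) ∨ or (applyUpTo (λ i → a (suc i) ≡ᵇ suc v) n))
    ≡⟨ count<-cong c (λ v _ → ∨-absorbˡ (repeated n refl v)) ⟩
  #[ v < c ] or (applyUpTo (λ i → a (suc i) ≡ᵇ suc v) n)
    ≡⟨ values≡descents c n (a ∘ suc) (antitone ∘ suc) (≤c ∘ suc) (λ i n≤i → vanish (suc i) (s≤s n≤i)) ⟩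
  #[ i < n ] (a (suc (suc i)) <ᵇ a (suc i))
    ≡⟨ cong (λ k → 𝟙 k + #[ i < n ] (a (suc (suc i)) <ᵇ a (suc i))) (≮ᵇ-intro (≤-reflexive (sym a₁≡a₀))) ⟨
  #[ i < suc n ] (a (suc i) <ᵇ a i) ∎
  where
  open ≡-Reasoning
  repeated : ∀ m → m ≡ n → ∀ v → (a 0 ≡ᵇ suc v) ≡ true → or (applyUpTo (λ i → a (suc i) ≡ᵇ suc v) m) ≡ true
  repeated zero    0≡n v a₀≡ =
    ⊥-elim (0≢1+n (trans (sym (vanish 1 (s≤s (≤-reflexive (sym 0≡n))))) (trans a₁≡a₀ (≡ᵇ-elim a₀≡))))
  repeated (suc m) _   v a₀≡ =
    cong (_∨ or (applyUpTo (λ i → a (suc (suc i)) ≡ᵇ suc v) m)) (trans (cong (_≡ᵇ suc v) a₁≡a₀) a₀≡)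

-- LPP tables and plane partitions

module Correspondence (b c K : ℕ) where

  record IsLPPTable (H : Array) : Set where
    field
      mono-down  : ∀ m t → m < b → t ≤ c → H m t ≤ H (suc m) t
      mono-right : ∀ m t → m ≤ b → t < c → H m t ≤ H m (suc t)
      top-zero   : ∀ t → H 0 t ≡ 0
      left-zero  : ∀ m → H m 0 ≡ 0
      ≤K         : ∀ m t → m ≤ b → t ≤ c → H m t ≤ K

  record IsPlanePartition (P : Array) : Set where
    field
      antitone-right : ∀ i j → P i (suc j) ≤ P i j
      antitone-down  : ∀ i j → P (suc i) j ≤ P i j
      ≤c             : ∀ i j → P i j ≤ c
      rows-vanish    : ∀ i j → b ≤ i → P i j ≡ 0
      columns-vanish : ∀ i j → K ≤ j → P i j ≡ 0

  toPP : Array → Array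
  toPP H r j = #[ t < c ] (j <ᵇ H (b ∸ r) (suc t))

  toTable : Array → Array
  toTable P zero    t = 0
  toTable P (suc m) t = #[ j < K ] ((suc c ∸ t) ≤ᵇ P (b ∸ suc m) j)

  increments : Array → Array
  increments H i t = H (suc i) (suc t) ∸ (H i (suc t) ⊔ H (suc i) t)

  descents : Array → ℕ
  descents P = ∑[ r < b ] #[ j < K ] (P (suc r) j <ᵇ P r j)

  columnContent : Array → ℕ
  columnContent P = ∑[ v < c ] #[ j < K ] or (applyUpTo (λ i → P i j ≡ᵇ suc v) b)

  b∸r≡1+b∸1+r : ∀ {r} → r < b → b ∸ r ≡ suc (b ∸ suc r)
  b∸r≡1+b∸1+r r<b = +-∸-assoc 1 r<b

  IsPlanePartition-resp : ∀ {P Q} → (∀ i j → P i j ≡ Q i j) → IsPlanePartition P → IsPlanePartition Q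
  IsPlanePartition-resp P≗Q pp = record
    { antitone-right = λ i j → subst₂ _≤_ (P≗Q i (suc j)) (P≗Q i j) (antitone-right i j)
    ; antitone-down  = λ i j → subst₂ _≤_ (P≗Q (suc i) j) (P≗Q i j) (antitone-down i j)
    ; ≤c             = λ i j → subst (_≤ c) (P≗Q i j) (≤c i j)
    ; rows-vanish    = λ i j b≤i → trans (sym (P≗Q i j)) (rows-vanish i j b≤i)
    ; columns-vanish = λ i j K≤j → trans (sym (P≗Q i j)) (columns-vanish i j K≤j)
    }
    where open IsPlanePartition pp

  toPP-cong : ∀ {H H′} → (∀ m t → m ≤ b → t ≤ c → H m t ≡ H′ m t) → ∀ r j → toPP H r j ≡ toPP H′ r j
  toPP-cong H≗H′ r j = count<-cong c (λ t t<c → cong (j <ᵇ_) (H≗H′ (b ∸ r) (suc t) (m∸n≤m b r) t<c))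

  toTable-cong : ∀ {P Q} → (∀ i j → P i j ≡ Q i j) → ∀ m t → toTable P m t ≡ toTable Q m t
  toTable-cong P≗Q zero    t = refl
  toTable-cong P≗Q (suc m) t = count<-cong K (λ j _ → cong ((suc c ∸ t) ≤ᵇ_) (P≗Q _ j))

  descents-cong : ∀ {P Q} → (∀ i j → P i j ≡ Q i j) → descents P ≡ descents Q
  descents-cong P≗Q = ∑-cong b (λ r _ → count<-cong K (λ j _ → cong₂ _<ᵇ_ (P≗Q (suc r) j) (P≗Q r j)))

  module _ {H : Array} (table : IsLPPTable H) where
    open IsLPPTable table

    toPP-isPlanePartition : IsPlanePartition (toPP H)
    toPP-isPlanePartition = record
      { antitone-right = λ i j → count<-mono c (λ t _ 1+j<H →
          <ᵇ-intro {j} {H (b ∸ i) (suc t)} (<-trans (n<1+n j) (<ᵇ-elim {suc j} 1+j<H)))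
      ; antitone-down  = λ i j → count<-mono c (λ t t<c j<H → <ᵇ-intro (<-≤-trans (<ᵇ-elim j<H)
          (stepwise-mono (λ m → H m (suc t)) b (λ m m<b → mono-down m (suc t) m<b t<c)
                         (∸-monoʳ-≤ b (n≤1+n i)) (m∸n≤m b i))))
      ; ≤c             = λ i j → count<-≤ c _
      ; rows-vanish    = λ i j b≤i → count<-none c (λ t _ →
          trans (cong (λ m → j <ᵇ H m (suc t)) (m≤n⇒m∸n≡0 b≤i)) (cong (j <ᵇ_) (top-zero (suc t))))
      ; columns-vanish = λ i j K≤j → count<-none c (λ t t<c → ≮ᵇ-intro (≤-trans (≤K (b ∸ i) (suc t) (m∸n≤m b i) t<c) K≤j))
      }

    toTable∘toPP : ∀ m t → m ≤ b → t ≤ c → toTable (toPP H) m t ≡ H m t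
    toTable∘toPP zero    t       _   _   = sym (top-zero t)
    toTable∘toPP (suc m) zero    _   _   =
      trans (count<-none K (λ j _ → ≰ᵇ-intro (s≤s (count<-≤ c _)))) (sym (left-zero (suc m)))
    toTable∘toPP (suc m) (suc t) m<b t<c = begin
      #[ j < K ] ((c ∸ t) ≤ᵇ toPP H (b ∸ suc m) j)
        ≡⟨ count<-cong K (λ j _ → cong (λ n → (c ∸ t) ≤ᵇ #[ t′ < c ] (j <ᵇ H n (suc t′))) (m∸[m∸n]≡n m<b)) ⟩
      #[ j < K ] ((c ∸ t) ≤ᵇ #[ t′ < c ] (j <ᵇ H (suc m) (suc t′)))
        ≡⟨ count<-cong K (λ j _ → count<-upClosed c (rising (suc m) j m<b) t t<c) ⟩
      #[ j < K ] (j <ᵇ H (suc m) (suc t))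
        ≡⟨ count<-initial K _ (≤K (suc m) (suc t) m<b t<c) ⟩
      H (suc m) (suc t) ∎
      where
      open ≡-Reasoning
      rising : ∀ m j → m ≤ b → ∀ t → suc t < c → (j <ᵇ H m (suc t)) ≡ true → (j <ᵇ H m (suc (suc t))) ≡ true
      rising m j m≤b t 1+t<c j<H = <ᵇ-intro (<-≤-trans (<ᵇ-elim j<H) (mono-right m (suc t) m≤b 1+t<c))

    rowLength-toPP : 1 ≤ c → ∀ r → #[ j < K ] (0 <ᵇ toPP H r j) ≡ H (b ∸ r) c
    rowLength-toPP 1≤c r = begin
      #[ j < K ] (1 ≤ᵇ toPP H r j)
        ≡⟨ count<-cong K (λ j _ → cong (_≤ᵇ toPP H r j) (m∸[m∸n]≡n 1≤c)) ⟨
      #[ j < K ] ((c ∸ (c ∸ 1)) ≤ᵇ toPP H r j)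
        ≡⟨ count<-cong K (λ j _ → count<-upClosed c (rising j) (c ∸ 1) (≤-reflexive (m+[n∸m]≡n 1≤c))) ⟩
      #[ j < K ] (j <ᵇ H (b ∸ r) (suc (c ∸ 1)))
        ≡⟨ cong (λ t → #[ j < K ] (j <ᵇ H (b ∸ r) t)) (m+[n∸m]≡n 1≤c) ⟩
      #[ j < K ] (j <ᵇ H (b ∸ r) c)
        ≡⟨ count<-initial K _ (≤K (b ∸ r) c (m∸n≤m b r) ≤-refl) ⟩
      H (b ∸ r) c ∎
      where
      open ≡-Reasoning
      rising : ∀ j t → suc t < c → (j <ᵇ H (b ∸ r) (suc t)) ≡ true → (j <ᵇ H (b ∸ r) (suc (suc t))) ≡ true
      rising j t 1+t<c j<H = <ᵇ-intro (<-≤-trans (<ᵇ-elim j<H) (mono-right (b ∸ r) (suc t) (m∸n≤m b r) 1+t<c))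

    descents-toPP : descents (toPP H) ≡ ∑[ i < b ] ∑[ t < c ] increments H i t
    descents-toPP = trans (∑-cong b row) (∑-reverse b (λ i → ∑[ t < c ] increments H i t))
      where
      row : ∀ r → r < b → #[ j < K ] (toPP H (suc r) j <ᵇ toPP H r j) ≡ ∑[ t < c ] increments H (b ∸ suc r) t
      row r r<b = trans (count<-cong K (λ j _ → cong (λ m → toPP H (suc r) j <ᵇ #[ t < c ] (j <ᵇ H m (suc t))) b∸r≡1+i))
                        (ConjugateDescents.descents-conj c K (H (suc i)) (H i)
                           (λ t t≤c → mono-down i t i<b t≤c) (λ t t<c → mono-right (suc i) t i<b t<c)
                           (λ t t<c → mono-right i t (<⇒≤ i<b) t<c) (left-zero (suc i)) (≤K (suc i) c i<b ≤-refl)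
                           c ≤-refl)
        where
        i : ℕ
        i = b ∸ suc r
        b∸r≡1+i : b ∸ r ≡ suc i
        b∸r≡1+i = b∸r≡1+b∸1+r r<b
        i<b : i < b
        i<b = subst (_≤ b) b∸r≡1+i (m∸n≤m b r)

  module _ {P : Array} (pp : IsPlanePartition P) where
    open IsPlanePartition pp

    toTable-row : ∀ r t → r < b → toTable P (b ∸ r) t ≡ #[ j < K ] ((suc c ∸ t) ≤ᵇ P r j)
    toTable-row r t r<b = begin
      toTable P (b ∸ r) t
        ≡⟨ cong (λ m → toTable P m t) (b∸r≡1+b∸1+r r<b) ⟩
      #[ j < K ] ((suc c ∸ t) ≤ᵇ P (b ∸ suc (b ∸ suc r)) j)
        ≡⟨ cong (λ i → #[ j < K ] ((suc c ∸ t) ≤ᵇ P i j)) (trans (cong (b ∸_) (sym (b∸r≡1+b∸1+r r<b))) (m∸[m∸n]≡n (<⇒≤ r<b))) ⟩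
      #[ j < K ] ((suc c ∸ t) ≤ᵇ P r j) ∎
      where open ≡-Reasoning

    toTable-isLPPTable : IsLPPTable (toTable P)
    toTable-isLPPTable = record
      { mono-down  = mono-down
      ; mono-right = mono-right
      ; top-zero   = λ t → refl
      ; left-zero  = left-zero
      ; ≤K         = ≤K
      }
      where
      mono-down : ∀ m t → m < b → t ≤ c → toTable P m t ≤ toTable P (suc m) t
      mono-down zero    t _ _ = z≤n
      mono-down (suc m) t _ _ = count<-mono K (λ j _ le → ≤ᵇ-intro {suc c ∸ t} (≤-trans (≤ᵇ-elim le)
        (stepwise-antitone (λ i → P i j) (b ∸ suc m) (λ i _ → antitone-down i j) (∸-monoʳ-≤ b (n≤1+n (suc m))) ≤-refl)))
      mono-right : ∀ m t → m ≤ b → t < c → toTable P m t ≤ toTable P m (suc t)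
      mono-right zero    t _ _ = z≤n
      mono-right (suc m) t _ _ = count<-mono K (λ j _ le → ≤ᵇ-intro (≤-trans (∸-monoʳ-≤ (suc c) (n≤1+n t)) (≤ᵇ-elim le)))
      left-zero : ∀ m → toTable P m 0 ≡ 0
      left-zero zero    = refl
      left-zero (suc m) = count<-none K (λ j _ → ≰ᵇ-intro (s≤s (≤c _ j)))
      ≤K : ∀ m t → m ≤ b → t ≤ c → toTable P m t ≤ K
      ≤K zero    t _ _ = z≤n
      ≤K (suc m) t _ _ = count<-≤ K _

    toPP∘toTable : ∀ r j → toPP (toTable P) r j ≡ P r j
    toPP∘toTable r j with r <? b
    ... | no  r≮b = trans (count<-none c (λ t _ → cong (λ m → j <ᵇ toTable P m (suc t)) (m≤n⇒m∸n≡0 (≮⇒≥ r≮b))))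
                          (sym (rows-vanish r j (≮⇒≥ r≮b)))
    ... | yes r<b = begin
      #[ t < c ] (j <ᵇ toTable P (b ∸ r) (suc t))
        ≡⟨ count<-cong c (λ t _ → cong (j <ᵇ_) (toTable-row r (suc t) r<b)) ⟩
      #[ t < c ] (j <ᵇ #[ j′ < K ] ((c ∸ t) ≤ᵇ P r j′))
        ≡⟨ count<-cong c (λ t t<c → count<-downClosed K (falling t) (vanishing t t<c) j) ⟩
      #[ t < c ] ((c ∸ t) ≤ᵇ P r j)
        ≡⟨ count<-threshold c (P r j) (≤c r j) ⟩
      P r j ∎
      where
      open ≡-Reasoning
      falling : ∀ t j′ → ((c ∸ t) ≤ᵇ P r (suc j′)) ≡ true → ((c ∸ t) ≤ᵇ P r j′) ≡ true
      falling t j′ le = ≤ᵇ-intro {c ∸ t} (≤-trans (≤ᵇ-elim le) (antitone-right r j′))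
      vanishing : ∀ t → t < c → ∀ j′ → K ≤ j′ → ((c ∸ t) ≤ᵇ P r j′) ≡ false
      vanishing t t<c j′ K≤j′ = ≰ᵇ-intro (subst (_< c ∸ t) (sym (columns-vanish r j′ K≤j′)) (m<n⇒0<n∸m t<c))

    columnContent≡descents : columnContent P ≡ descents P
    columnContent≡descents = begin
      ∑[ v < c ] ∑[ j < K ] 𝟙 (or (applyUpTo (λ i → P i j ≡ᵇ suc v) b))
        ≡⟨ ∑-swap c K _ ⟩
      ∑[ j < K ] #[ v < c ] or (applyUpTo (λ i → P i j ≡ᵇ suc v) b)
        ≡⟨ ∑-cong K (λ j _ → values≡descents c b (λ i → P i j) (λ i → antitone-down i j) (λ i → ≤c i j)
                                             (λ i b≤i → rows-vanish i j b≤i)) ⟩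
      ∑[ j < K ] #[ i < b ] (P (suc i) j <ᵇ P i j)
        ≡⟨ ∑-swap K b _ ⟩
      descents P ∎
      where open ≡-Reasoning

lppShape : ∀ {b} c → Vec ℕ b → Mat b c → Bool
lppShape {b} c lam W = and (map (λ i → G (b ∸ toℕ i) c W ≡ᵇ V.lookup lam i) (allFin b))

largestPart : ∀ {b} → Vec ℕ b → ℕ
largestPart lam = V.foldr (λ _ → ℕ) _⊔_ 0 lam

G≤largestPart : ∀ {b c} (lam : Vec ℕ (suc b)) (W : Mat (suc b) c) → lppShape c lam W ≡ true → G (suc b) c W ≤ largestPart lam
G≤largestPart (x V.∷ lam) W shape = subst (_≤ x ⊔ largestPart lam) (sym (≡ᵇ-elim (∧-conicalˡ _ _ shape))) (m≤m⊔n x _)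

module Bijection (b c K : ℕ) where

  open Correspondence b c K
  open LastPassage using (lpp; lpp-left-zero; lpp-mono-down; lpp-mono-right; G≡lpp)
  open ≡-Reasoning

  desCount≡descents : (π : Mat b K) → desCount π ≡ descents (entry π)
  desCount≡descents π =
    trans (cong sum (map-upTo _ b)) (trans (sum-applyUpTo _ b) (∑-cong b (λ i _ → count-applyUpTo _ id K)))

  colContent≡columnContent : (π : Mat b K) → colContent c π ≡ columnContent (entry π)
  colContent≡columnContent π = trans (cong sum (map-upTo _ c)) (trans (sum-applyUpTo _ c)
    (∑-cong c (λ v _ → trans (count-applyUpTo _ id K) (count<-cong K (λ j _ → cong or (map-upTo _ b))))))

  rowLen≡count< : (π : Mat b K) → ∀ r → rowLen π r ≡ #[ j < K ] (0 <ᵇ entry π r j)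
  rowLen≡count< π r = count-applyUpTo _ id K

  isPPᵇ⇒ : (π : Mat b K) → (∀ i j → entry π i j ≤ c) → isPPᵇ π ≡ true → IsPlanePartition (entry π)
  isPPᵇ⇒ π ≤c isPP = record
    { antitone-right = right
    ; antitone-down  = down
    ; ≤c             = ≤c
    ; rows-vanish    = entry-below π
    ; columns-vanish = entry-right π
    }
    where
    inside : ∀ i j → i < b → j < K → ((entry π i (suc j) ≤ᵇ entry π i j) ∧ (entry π (suc i) j ≤ᵇ entry π i j)) ≡ true
    inside i j i<b j<K = and-upTo⁻ _ K (and-upTo⁻ _ b isPP i i<b) j j<K
    right : ∀ i j → entry π i (suc j) ≤ entry π i j
    right i j with i <? b | j <? K
    ... | yes i<b | yes j<K = ≤ᵇ-elim (∧-conicalˡ _ _ (inside i j i<b j<K))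
    ... | no  i≮b | _       = ≡0⇒≤ (entry-below π i (suc j) (≮⇒≥ i≮b))
    ... | yes _   | no  j≮K = ≡0⇒≤ (entry-right π i (suc j) (≤-trans (≮⇒≥ j≮K) (n≤1+n j)))
    down : ∀ i j → entry π (suc i) j ≤ entry π i j
    down i j with i <? b | j <? K
    ... | yes i<b | yes j<K = ≤ᵇ-elim (∧-conicalʳ (entry π i (suc j) ≤ᵇ entry π i j) _ (inside i j i<b j<K))
    ... | no  i≮b | _       = ≡0⇒≤ (entry-below π (suc i) j (≤-trans (≮⇒≥ i≮b) (n≤1+n i)))
    ... | yes _   | no  j≮K = ≡0⇒≤ (entry-right π (suc i) j (≮⇒≥ j≮K))

  isPPᵇ⇐ : (π : Mat b K) → IsPlanePartition (entry π) → isPPᵇ π ≡ true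
  isPPᵇ⇐ π pp = and-upTo⁺ _ b (λ i _ → and-upTo⁺ _ K (λ j _ →
    cong₂ _∧_ (≤ᵇ-intro (antitone-right i j)) (≤ᵇ-intro (antitone-down i j))))
    where open IsPlanePartition pp

  module _ (W : Mat b c) where

    lpp-isLPPTable : lpp W b c ≤ K → IsLPPTable (lpp W)
    lpp-isLPPTable fits = record
      { mono-down  = λ m t _ _ → lpp-mono-down W m t
      ; mono-right = λ m t _ _ → lpp-mono-right W m t
      ; top-zero   = λ t → refl
      ; left-zero  = lpp-left-zero W
      ; ≤K         = λ m t m≤b t≤c → ≤-trans (stepwise-mono (λ m → lpp W m t) b (λ m _ → lpp-mono-down W m t) m≤b ≤-refl)
                                    (≤-trans (stepwise-mono (lpp W b) c (λ t _ → lpp-mono-right W b t) t≤c ≤-refl) fits)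
      }

    increments-lpp : ∀ i t → increments (lpp W) i t ≡ entry W i t
    increments-lpp i t = m+n∸m≡n (lpp W i (suc t) ⊔ lpp W (suc i) t) (entry W i t)

  lpp-tabulateMat-increments : ∀ {H} → IsLPPTable H →
    ∀ m t → m ≤ b → t ≤ c → lpp (tabulateMat b c (increments H)) m t ≡ H m t
  lpp-tabulateMat-increments table zero    t       _   _   = sym (IsLPPTable.top-zero table t)
  lpp-tabulateMat-increments table (suc m) zero    _   _   = sym (IsLPPTable.left-zero table (suc m))
  lpp-tabulateMat-increments {H} table (suc m) (suc t) m<b t<c = begin
    (lpp W′ m (suc t) ⊔ lpp W′ (suc m) t) + entry W′ m t
      ≡⟨ cong₂ (λ x y → (x ⊔ y) + entry W′ m t)
               (lpp-tabulateMat-increments table m (suc t) (<⇒≤ m<b) t<c)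
               (lpp-tabulateMat-increments table (suc m) t m<b (<⇒≤ t<c)) ⟩
    (H m (suc t) ⊔ H (suc m) t) + entry W′ m t
      ≡⟨ cong ((H m (suc t) ⊔ H (suc m) t) +_) (entry-tabulateMat b c _ m t m<b t<c) ⟩
    (H m (suc t) ⊔ H (suc m) t) + increments H m t
      ≡⟨ m+[n∸m]≡n (⊔-lub (mono-down m (suc t) m<b t<c) (mono-right (suc m) t m<b t<c)) ⟩
    H (suc m) (suc t) ∎
    where
    open IsLPPTable table
    W′ : Mat b c
    W′ = tabulateMat b c (increments H)

  toπ : Mat b c → Mat b K
  toπ W = tabulateMat b K (toPP (lpp W))

  toW : Mat b K → Mat b c
  toW π = tabulateMat b c (increments (toTable (entry π)))

  module Forward (W : Mat b c) (fits : lpp W b c ≤ K) where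

    table : IsLPPTable (lpp W)
    table = lpp-isLPPTable W fits

    entry-toπ : ∀ i j → entry (toπ W) i j ≡ toPP (lpp W) i j
    entry-toπ = entry-tabulateMat-supported b K _ rows-vanish columns-vanish
      where open IsPlanePartition (toPP-isPlanePartition table)

    toπ-isPlanePartition : IsPlanePartition (entry (toπ W))
    toπ-isPlanePartition = IsPlanePartition-resp (λ i j → sym (entry-toπ i j)) (toPP-isPlanePartition table)

    toπ-∈ : toπ W ∈ matsUpTo b K c
    toπ-∈ = ∈-matsUpTo⁺ c (toπ W) (IsPlanePartition.≤c toπ-isPlanePartition)

    isPPᵇ-toπ : isPPᵇ (toπ W) ≡ true
    isPPᵇ-toπ = isPPᵇ⇐ (toπ W) toπ-isPlanePartition

    desCount-toπ : desCount (toπ W) ≡ total W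
    desCount-toπ = begin
      desCount (toπ W)                                 ≡⟨ desCount≡descents (toπ W) ⟩
      descents (entry (toπ W))                         ≡⟨ descents-cong entry-toπ ⟩
      descents (toPP (lpp W))                          ≡⟨ descents-toPP table ⟩
      ∑[ i < b ] ∑[ t < c ] increments (lpp W) i t     ≡⟨ ∑-cong b (λ i _ → ∑-cong c (λ t _ → increments-lpp W i t)) ⟩
      ∑[ i < b ] ∑[ t < c ] entry W i t                ≡⟨ total≡∑ W ⟨
      total W                                          ∎

    colContent-toπ : colContent c (toπ W) ≡ total W
    colContent-toπ = begin
      colContent c (toπ W)           ≡⟨ colContent≡columnContent (toπ W) ⟩
      columnContent (entry (toπ W))  ≡⟨ columnContent≡descents toπ-isPlanePartition ⟩
      descents (entry (toπ W))       ≡⟨ desCount≡descents (toπ W) ⟨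
      desCount (toπ W)               ≡⟨ desCount-toπ ⟩
      total W                        ∎

    rowLen-toπ : 1 ≤ c → ∀ r → rowLen (toπ W) r ≡ lpp W (b ∸ r) c
    rowLen-toπ 1≤c r = begin
      rowLen (toπ W) r                       ≡⟨ rowLen≡count< (toπ W) r ⟩
      #[ j < K ] (0 <ᵇ entry (toπ W) r j)    ≡⟨ count<-cong K (λ j _ → cong (0 <ᵇ_) (entry-toπ r j)) ⟩
      #[ j < K ] (0 <ᵇ toPP (lpp W) r j)     ≡⟨ rowLength-toPP table 1≤c r ⟩
      lpp W (b ∸ r) c                        ∎

    toW∘toπ : toW (toπ W) ≡ W
    toW∘toπ = Mat-ext _ _ λ i t i<b t<c → begin
      entry (toW (toπ W)) i t                   ≡⟨ entry-tabulateMat b c _ i t i<b t<c ⟩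
      increments (toTable (entry (toπ W))) i t  ≡⟨ cong₂ _∸_ (recover (suc i) (suc t) i<b t<c)
                                                      (cong₂ _⊔_ (recover i (suc t) (<⇒≤ i<b) t<c) (recover (suc i) t i<b (<⇒≤ t<c))) ⟩
      increments (lpp W) i t                    ≡⟨ increments-lpp W i t ⟩
      entry W i t                               ∎
      where
      recover : ∀ m t → m ≤ b → t ≤ c → toTable (entry (toπ W)) m t ≡ lpp W m t
      recover m t m≤b t≤c = trans (toTable-cong entry-toπ m t) (toTable∘toPP table m t m≤b t≤c)

  module Backward (π : Mat b K) (≤c : ∀ i j → entry π i j ≤ c) (isPP : isPPᵇ π ≡ true) where

    pp : IsPlanePartition (entry π)
    pp = isPPᵇ⇒ π ≤c isPP

    table : IsLPPTable (toTable (entry π))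
    table = toTable-isLPPTable pp

    lpp-toW : ∀ m t → m ≤ b → t ≤ c → lpp (toW π) m t ≡ toTable (entry π) m t
    lpp-toW = lpp-tabulateMat-increments table

    total-toW : total (toW π) ≡ desCount π
    total-toW = begin
      total (toW π)                                             ≡⟨ total≡∑ (toW π) ⟩
      ∑[ i < b ] ∑[ t < c ] entry (toW π) i t
        ≡⟨ ∑-cong b (λ i i<b → ∑-cong c (λ t t<c → entry-tabulateMat b c _ i t i<b t<c)) ⟩
      ∑[ i < b ] ∑[ t < c ] increments (toTable (entry π)) i t  ≡⟨ descents-toPP table ⟨
      descents (toPP (toTable (entry π)))                       ≡⟨ descents-cong (toPP∘toTable pp) ⟩
      descents (entry π)                                        ≡⟨ desCount≡descents π ⟨
      desCount π                                                ∎

    rowLen-toW : ∀ r → r < b → lpp (toW π) (b ∸ r) c ≡ rowLen π r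
    rowLen-toW r r<b = begin
      lpp (toW π) (b ∸ r) c                     ≡⟨ lpp-toW (b ∸ r) c (m∸n≤m b r) ≤-refl ⟩
      toTable (entry π) (b ∸ r) c               ≡⟨ toTable-row pp r c r<b ⟩
      #[ j < K ] ((suc c ∸ c) ≤ᵇ entry π r j)   ≡⟨ count<-cong K (λ j _ → cong (_≤ᵇ entry π r j) (m+n∸n≡m 1 c)) ⟩
      #[ j < K ] (1 ≤ᵇ entry π r j)             ≡⟨ rowLen≡count< π r ⟨
      rowLen π r                                ∎

    toπ∘toW : toπ (toW π) ≡ π
    toπ∘toW = Mat-ext _ _ λ i j i<b j<K → begin
      entry (toπ (toW π)) i j       ≡⟨ entry-tabulateMat b K _ i j i<b j<K ⟩
      toPP (lpp (toW π)) i j        ≡⟨ toPP-cong lpp-toW i j ⟩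
      toPP (toTable (entry π)) i j  ≡⟨ toPP∘toTable pp i j ⟩
      entry π i j                   ∎

  count-transfer : ∀ k (pW : Mat b c → Bool) (pπ : Mat b K → Bool) →
    (∀ W → pW W ≡ true → lpp W b c ≤ K × pπ (toπ W) ≡ true) →
    (∀ π → (∀ i j → entry π i j ≤ c) → pπ π ≡ true → isPPᵇ π ≡ true × total (toW π) ≤ k × pW (toW π) ≡ true) →
    count pW (matsUpTo b c k) ≡ count pπ (matsUpTo b K c)
  count-transfer k pW pπ forth back =
    count-bijection toπ toW (matsUpTo-unique b c k) (matsUpTo-unique b K c) forth′ back′
    where
    forth′ : ∀ {W} → W ∈ matsUpTo b c k → pW W ≡ true → toπ W ∈ matsUpTo b K c × pπ (toπ W) ≡ true × toW (toπ W) ≡ W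
    forth′ {W} _ pW with fits , pπ ← forth W pW = Forward.toπ-∈ W fits , pπ , Forward.toW∘toπ W fits
    back′ : ∀ {π} → π ∈ matsUpTo b K c → pπ π ≡ true → toW π ∈ matsUpTo b c k × pW (toW π) ≡ true × toπ (toW π) ≡ π
    back′ {π} π∈ pπ with ≤c ← ∈-matsUpTo⁻ c π π∈ with isPP , small , pW ← back π ≤c pπ =
      ∈-matsUpTo⁺ k (toW π) (λ i j → ≤-trans (entry≤total (toW π) i j) small) , pW , Backward.toπ∘toW π ≤c isPP

  module _ (1≤c : 1 ≤ c) (lam : Vec ℕ b) where

    hasShape-toπ : ∀ W → lpp W b c ≤ K → hasShapeᵇ lam (toπ W) ≡ lppShape c lam W
    hasShape-toπ W fits = cong and (map-cong (λ i → cong (_≡ᵇ V.lookup lam i)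
      (trans (Forward.rowLen-toπ W fits 1≤c (toℕ i)) (sym (G≡lpp W (m<n⇒0<n∸m (toℕ<n i)) 1≤c)))) (allFin b))

    lppShape-toW : ∀ π (≤c : ∀ i j → entry π i j ≤ c) (isPP : isPPᵇ π ≡ true) → lppShape c lam (toW π) ≡ hasShapeᵇ lam π
    lppShape-toW π ≤c isPP = cong and (map-cong (λ i → cong (_≡ᵇ V.lookup lam i)
      (trans (G≡lpp (toW π) (m<n⇒0<n∸m (toℕ<n i)) 1≤c) (Backward.rowLen-toW π ≤c isPP (toℕ i) (toℕ<n i)))) (allFin b))

-- Weight matrices counted by total weight

vecCount : ℕ → ℕ → ℕ
vecCount c k = count (λ v → sum (V.toList v) ≡ᵇ k) (vecsUpTo c k)

matCount : ℕ → ℕ → ℕ → ℕ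
matCount b c k = count (λ W → total W ≡ᵇ k) (matsUpTo b c k)

vecCount-anyBound : ∀ c {k B} → k ≤ B → count (λ v → sum (V.toList v) ≡ᵇ k) (vecsUpTo c B) ≡ vecCount c k
vecCount-anyBound c {k} {B} k≤B = count-bijection id id (vecsUpTo-unique c B) (vecsUpTo-unique c k)
  (λ {v} _ ok → ∈-vecsUpTo⁺ k v (small v ok) , ok , refl)
  (λ {v} _ ok → ∈-vecsUpTo⁺ B v (λ j → ≤-trans (small v ok j) k≤B) , ok , refl)
  where
  small : ∀ v → (sum (V.toList v) ≡ᵇ k) ≡ true → ∀ j → vecEntry v j ≤ k
  small v ok j = subst (vecEntry v j ≤_) (≡ᵇ-elim ok) (vecEntry≤sum v j)

matCount-anyBound : ∀ b c {k B} → k ≤ B → count (λ W → total W ≡ᵇ k) (matsUpTo b c B) ≡ matCount b c k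
matCount-anyBound b c {k} {B} k≤B = count-bijection id id (matsUpTo-unique b c B) (matsUpTo-unique b c k)
  (λ {W} _ ok → ∈-matsUpTo⁺ k W (small W ok) , ok , refl)
  (λ {W} _ ok → ∈-matsUpTo⁺ B W (λ i j → ≤-trans (small W ok i j) k≤B) , ok , refl)
  where
  small : ∀ W → (total W ≡ᵇ k) ≡ true → ∀ i j → entry W i j ≤ k
  small W ok i j = subst (entry W i j ≤_) (≡ᵇ-elim ok) (entry≤total W i j)

vecCount-suc : ∀ c k → vecCount (suc c) k ≡ ∑[ s < suc k ] (1 * vecCount c (k ∸ s))
vecCount-suc c k = begin
  vecCount (suc c) k
    ≡⟨ count-∷-product (λ v → sum (V.toList v)) id (λ v → sum (V.toList v)) (λ _ _ → refl) (upTo (suc k)) (vecsUpTo c k) k ⟩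
  ∑[ s < suc k ] (count (λ x → s ≡ᵇ x) (upTo (suc k)) * count (λ v → sum (V.toList v) ≡ᵇ k ∸ s) (vecsUpTo c k))
    ≡⟨ ∑-cong (suc k) (λ s s≤k → cong₂ _*_ (trans (count-applyUpTo (s ≡ᵇ_) id (suc k)) (count<-≡ᵇ (suc k) s s≤k))
                                            (vecCount-anyBound c (m∸n≤m k s))) ⟩
  ∑[ s < suc k ] (1 * vecCount c (k ∸ s)) ∎
  where open ≡-Reasoning

matCount-suc : ∀ b c k → matCount (suc b) c k ≡ ∑[ s < suc k ] (vecCount c s * matCount b c (k ∸ s))
matCount-suc b c k = begin
  matCount (suc b) c k
    ≡⟨ count-∷-product total (λ v → sum (V.toList v)) total (λ _ _ → refl) (vecsUpTo c k) (matsUpTo b c k) k ⟩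
  ∑[ s < suc k ] (count (λ v → s ≡ᵇ sum (V.toList v)) (vecsUpTo c k) * count (λ W → total W ≡ᵇ k ∸ s) (matsUpTo b c k))
    ≡⟨ ∑-cong (suc k) (λ s s≤k → cong₂ _*_ (trans (count-cong (λ v → ≡ᵇ-sym s (sum (V.toList v))) (vecsUpTo c k))
                                                  (vecCount-anyBound c (≤-pred s≤k)))
                                            (matCount-anyBound b c (m∸n≤m k s))) ⟩
  ∑[ s < suc k ] (vecCount c s * matCount b c (k ∸ s)) ∎
  where open ≡-Reasoning

lppCount≡gNumCount : ∀ b c → 1 ≤ c → ∀ lam k → lppCount b c lam k ≡ gNumCount b c lam k
lppCount≡gNumCount b c 1≤c lam k = count-transfer k _ _ forth back
  where
  open Bijection b c k
  forth : ∀ W → ((total W ≡ᵇ k) ∧ lppShape c lam W) ≡ true →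
    LastPassage.lpp W b c ≤ k × (isPPᵇ (toπ W) ∧ hasShapeᵇ lam (toπ W) ∧ (desCount (toπ W) ≡ᵇ k)) ≡ true
  forth W ok = fits , cong₂ _∧_ F.isPPᵇ-toπ (cong₂ _∧_ (trans (hasShape-toπ 1≤c lam W fits) (∧-conicalʳ _ _ ok))
                                                       (≡ᵇ-intro (trans F.desCount-toπ total≡k)))
    where
    total≡k : total W ≡ k
    total≡k = ≡ᵇ-elim (∧-conicalˡ _ _ ok)
    fits : LastPassage.lpp W b c ≤ k
    fits = ≤-trans (LastPassage.lpp≤total W) (≤-reflexive total≡k)
    module F = Forward W fits
  back : ∀ π → (∀ i j → entry π i j ≤ c) → (isPPᵇ π ∧ hasShapeᵇ lam π ∧ (desCount π ≡ᵇ k)) ≡ true →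
    isPPᵇ π ≡ true × total (toW π) ≤ k × ((total (toW π) ≡ᵇ k) ∧ lppShape c lam (toW π)) ≡ true
  back π ≤c ok = isPP , ≤-reflexive total≡k , cong₂ _∧_ (≡ᵇ-intro total≡k) (trans (lppShape-toW 1≤c lam π ≤c isPP) shape)
    where
    isPP : isPPᵇ π ≡ true
    isPP = ∧-conicalˡ _ _ ok
    shape : hasShapeᵇ lam π ≡ true
    shape = ∧-conicalˡ _ _ (∧-conicalʳ (isPPᵇ π) _ ok)
    total≡k : total (toW π) ≡ k
    total≡k = trans (Backward.total-toW π ≤c isPP) (≡ᵇ-elim (∧-conicalʳ (hasShapeᵇ lam π) _ (∧-conicalʳ (isPPᵇ π) _ ok)))

ZCount≡matCount : ∀ b c k → ZCount b c k ≡ matCount b c k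
ZCount≡matCount b c k = sym (count-transfer k _ _ forth back)
  where
  open Bijection b c k
  forth : ∀ W → (total W ≡ᵇ k) ≡ true → LastPassage.lpp W b c ≤ k × (isPPᵇ (toπ W) ∧ (desCount (toπ W) ≡ᵇ k)) ≡ true
  forth W ok = fits , cong₂ _∧_ F.isPPᵇ-toπ (≡ᵇ-intro (trans F.desCount-toπ (≡ᵇ-elim ok)))
    where
    fits : LastPassage.lpp W b c ≤ k
    fits = ≤-trans (LastPassage.lpp≤total W) (≤-reflexive (≡ᵇ-elim ok))
    module F = Forward W fits
  back : ∀ π → (∀ i j → entry π i j ≤ c) → (isPPᵇ π ∧ (desCount π ≡ᵇ k)) ≡ true →
    isPPᵇ π ≡ true × total (toW π) ≤ k × (total (toW π) ≡ᵇ k) ≡ true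
  back π ≤c ok = isPP , ≤-reflexive total≡k , ≡ᵇ-intro total≡k
    where
    isPP : isPPᵇ π ≡ true
    isPP = ∧-conicalˡ _ _ ok
    total≡k : total (toW π) ≡ k
    total≡k = trans (Backward.total-toW π ≤c isPP) (≡ᵇ-elim (∧-conicalʳ (isPPᵇ π) _ ok))

lppCount≡gCount : ∀ b c → 1 ≤ b → 1 ≤ c → ∀ lam k → lppCount b c lam k ≡ gCount b c lam k
lppCount≡gCount (suc b) c _ 1≤c lam k = count-transfer k _ _ forth back
  where
  open Bijection (suc b) c (largestPart lam)
  forth : ∀ W → ((total W ≡ᵇ k) ∧ lppShape c lam W) ≡ true →
    LastPassage.lpp W (suc b) c ≤ largestPart lam × (isPPᵇ (toπ W) ∧ hasShapeᵇ lam (toπ W) ∧ (colContent c (toπ W) ≡ᵇ k)) ≡ true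
  forth W ok = fits , cong₂ _∧_ F.isPPᵇ-toπ (cong₂ _∧_ (trans (hasShape-toπ 1≤c lam W fits) shape)
                                                       (≡ᵇ-intro (trans F.colContent-toπ (≡ᵇ-elim (∧-conicalˡ (total W ≡ᵇ k) _ ok)))))
    where
    shape : lppShape c lam W ≡ true
    shape = ∧-conicalʳ (total W ≡ᵇ k) _ ok
    fits : LastPassage.lpp W (suc b) c ≤ largestPart lam
    fits = subst (_≤ largestPart lam) (LastPassage.G≡lpp W (s≤s z≤n) 1≤c) (G≤largestPart lam W shape)
    module F = Forward W fits
  back : ∀ π → (∀ i j → entry π i j ≤ c) → (isPPᵇ π ∧ hasShapeᵇ lam π ∧ (colContent c π ≡ᵇ k)) ≡ true →
    isPPᵇ π ≡ true × total (toW π) ≤ k × ((total (toW π) ≡ᵇ k) ∧ lppShape c lam (toW π)) ≡ true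
  back π ≤c ok = isPP , ≤-reflexive total≡k , cong₂ _∧_ (≡ᵇ-intro total≡k) (trans (lppShape-toW 1≤c lam π ≤c isPP) shape)
    where
    isPP : isPPᵇ π ≡ true
    isPP = ∧-conicalˡ _ _ ok
    shape : hasShapeᵇ lam π ≡ true
    shape = ∧-conicalˡ _ _ (∧-conicalʳ (isPPᵇ π) _ ok)
    total≡k : total (toW π) ≡ k
    total≡k = begin
      total (toW π)                  ≡⟨ Backward.total-toW π ≤c isPP ⟩
      desCount π                     ≡⟨ desCount≡descents π ⟩
      Correspondence.descents (suc b) c (largestPart lam) (entry π)
        ≡⟨ Correspondence.columnContent≡descents (suc b) c (largestPart lam) (Backward.pp π ≤c isPP) ⟨
      Correspondence.columnContent (suc b) c (largestPart lam) (entry π)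
        ≡⟨ colContent≡columnContent π ⟨
      colContent c π                 ≡⟨ ≡ᵇ-elim (∧-conicalʳ (hasShapeᵇ lam π) _ (∧-conicalʳ (isPPᵇ π) _ ok)) ⟩
      k                              ∎
      where open ≡-Reasoning

-- Power series

module PowerSeries where

  open FiniteSums ℤP.+-*-isCommutativeSemiring using ()
    renaming (∑ to ∑ℤ; ∑-cong to ∑ℤ-cong; ∑-zero to ∑ℤ-zero; ∑-reverse to ∑ℤ-reverse;
              ∑-distribˡ to ∑ℤ-distribˡ; ∑-distribʳ to ∑ℤ-distribʳ; ∑-triangle to ∑ℤ-triangle)

  *ₛ-convolution : ∀ f g n → (f *ₛ g) n ≡ ∑ℤ (suc n) (λ i → f i ℤ.* g (n ∸ i))
  *ₛ-convolution f g n = go id (suc n)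
    where
    go : ∀ h m → convAux f g n (applyUpTo h m) ≡ ∑ℤ m (λ i → f (h i) ℤ.* g (n ∸ h i))
    go h zero    = refl
    go h (suc m) = cong (λ x → f (h 0) ℤ.* g (n ∸ h 0) ℤ.+ x) (go (h ∘ suc) m)

  *ₛ-cong : ∀ {f f′ g g′} → f ≗ f′ → g ≗ g′ → f *ₛ g ≗ f′ *ₛ g′
  *ₛ-cong {f} {f′} {g} {g′} f≗f′ g≗g′ n = begin
    (f *ₛ g) n                                ≡⟨ *ₛ-convolution f g n ⟩
    ∑ℤ (suc n) (λ i → f i ℤ.* g (n ∸ i))      ≡⟨ ∑ℤ-cong (suc n) (λ i _ → cong₂ ℤ._*_ (f≗f′ i) (g≗g′ (n ∸ i))) ⟩
    ∑ℤ (suc n) (λ i → f′ i ℤ.* g′ (n ∸ i))    ≡⟨ *ₛ-convolution f′ g′ n ⟨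
    (f′ *ₛ g′) n                              ∎
    where open ≡-Reasoning

  *ₛ-comm : ∀ f g → f *ₛ g ≗ g *ₛ f
  *ₛ-comm f g n = begin
    (f *ₛ g) n                                            ≡⟨ *ₛ-convolution f g n ⟩
    ∑ℤ (suc n) (λ i → f i ℤ.* g (n ∸ i))                  ≡⟨ ∑ℤ-reverse (suc n) (λ i → f i ℤ.* g (n ∸ i)) ⟨
    ∑ℤ (suc n) (λ i → f (n ∸ i) ℤ.* g (n ∸ (n ∸ i)))      ≡⟨ ∑ℤ-cong (suc n) (λ i i≤n → trans (cong (λ j → f (n ∸ i) ℤ.* g j) (m∸[m∸n]≡n (≤-pred i≤n)))
                                                                                           (ℤP.*-comm (f (n ∸ i)) (g i))) ⟩
    ∑ℤ (suc n) (λ i → g i ℤ.* f (n ∸ i))                  ≡⟨ *ₛ-convolution g f n ⟨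
    (g *ₛ f) n                                            ∎
    where open ≡-Reasoning

  *ₛ-assoc : ∀ f g h → (f *ₛ g) *ₛ h ≗ f *ₛ (g *ₛ h)
  *ₛ-assoc f g h n = begin
    ((f *ₛ g) *ₛ h) n
      ≡⟨ *ₛ-convolution (f *ₛ g) h n ⟩
    ∑ℤ (suc n) (λ i → (f *ₛ g) i ℤ.* h (n ∸ i))
      ≡⟨ ∑ℤ-cong (suc n) (λ i _ → trans (cong (ℤ._* h (n ∸ i)) (*ₛ-convolution f g i))
                                         (∑ℤ-distribʳ (suc i) (λ j → f j ℤ.* g (i ∸ j)) (h (n ∸ i)))) ⟩
    ∑ℤ (suc n) (λ i → ∑ℤ (suc i) (λ j → f j ℤ.* g (i ∸ j) ℤ.* h (n ∸ i)))
      ≡⟨ ∑ℤ-triangle n (λ j i → f j ℤ.* g (i ∸ j) ℤ.* h (n ∸ i)) ⟩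
    ∑ℤ (suc n) (λ j → ∑ℤ (suc (n ∸ j)) (λ l → f j ℤ.* g (j + l ∸ j) ℤ.* h (n ∸ (j + l))))
      ≡⟨ ∑ℤ-cong (suc n) (λ j _ → ∑ℤ-cong (suc (n ∸ j)) (λ l _ →
           trans (cong₂ (λ x y → f j ℤ.* g x ℤ.* h y) (m+n∸m≡n j l) (sym (∸-+-assoc n j l))) (ℤP.*-assoc (f j) (g l) _))) ⟩
    ∑ℤ (suc n) (λ j → ∑ℤ (suc (n ∸ j)) (λ l → f j ℤ.* (g l ℤ.* h (n ∸ j ∸ l))))
      ≡⟨ ∑ℤ-cong (suc n) (λ j _ → trans (sym (∑ℤ-distribˡ (suc (n ∸ j)) (λ l → g l ℤ.* h (n ∸ j ∸ l)) (f j)))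
                                         (cong (f j ℤ.*_) (sym (*ₛ-convolution g h (n ∸ j))))) ⟩
    ∑ℤ (suc n) (λ j → f j ℤ.* (g *ₛ h) (n ∸ j))
      ≡⟨ *ₛ-convolution f (g *ₛ h) n ⟨
    (f *ₛ (g *ₛ h)) n ∎
    where open ≡-Reasoning

  *ₛ-identityˡ : ∀ g → oneₛ *ₛ g ≗ g
  *ₛ-identityˡ g n = trans (*ₛ-convolution oneₛ g n)
    (trans (cong₂ ℤ._+_ (ℤP.*-identityˡ (g n)) (∑ℤ-zero n (λ _ _ → refl))) (ℤP.+-identityʳ (g n)))

  *ₛ-identityʳ : ∀ g → g *ₛ oneₛ ≗ g
  *ₛ-identityʳ g n = trans (*ₛ-comm g oneₛ n) (*ₛ-identityˡ g n)

  *ₛ-commutativeMonoid : CommutativeMonoid 0ℓ 0ℓ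
  *ₛ-commutativeMonoid = record
    { Carrier             = Series
    ; _≈_                 = _≗_
    ; _∙_                 = _*ₛ_
    ; ε                   = oneₛ
    ; isCommutativeMonoid = record
      { isMonoid = record
        { isSemigroup = record
          { isMagma = record { isEquivalence = Setoid.isEquivalence (ℕ →-setoid ℤ) ; ∙-cong = *ₛ-cong }
          ; assoc   = *ₛ-assoc
          }
        ; identity    = *ₛ-identityˡ , *ₛ-identityʳ
        }
      ; comm     = *ₛ-comm
      }
    }

  open CommutativeMonoid *ₛ-commutativeMonoid using (∙-cong; commutativeSemigroup)
  open CommutativeSemigroupProperties commutativeSemigroup using () renaming (interchange to *ₛ-interchange)

  ones : Series
  ones _ = ℤ.1ℤ

  oneMinusQ*ones : oneMinusQ *ₛ ones ≗ oneₛ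
  oneMinusQ*ones zero    = refl
  oneMinusQ*ones (suc n) =
    trans (*ₛ-convolution oneMinusQ ones (suc n)) (cong (λ x → ℤ.1ℤ ℤ.+ (ℤ.-1ℤ ℤ.+ x)) (∑ℤ-zero n (λ _ _ → refl)))

  ^ₛ-+ : ∀ X m n → X ^ₛ (m + n) ≗ (X ^ₛ m) *ₛ (X ^ₛ n)
  ^ₛ-+ X zero    n k = sym (*ₛ-identityˡ (X ^ₛ n) k)
  ^ₛ-+ X (suc m) n k = trans (*ₛ-cong {X} (λ _ → refl) (^ₛ-+ X m n) k) (sym (*ₛ-assoc X (X ^ₛ m) (X ^ₛ n) k))

  ^ₛ-inverse : ∀ {X Y} → X *ₛ Y ≗ oneₛ → ∀ n → (X ^ₛ n) *ₛ (Y ^ₛ n) ≗ oneₛ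
  ^ₛ-inverse XY≈1 zero = *ₛ-identityˡ oneₛ
  ^ₛ-inverse {X} {Y} XY≈1 (suc n) = begin
    (X *ₛ (X ^ₛ n)) *ₛ (Y *ₛ (Y ^ₛ n))  ≈⟨ *ₛ-interchange X (X ^ₛ n) Y (Y ^ₛ n) ⟩
    (X *ₛ Y) *ₛ ((X ^ₛ n) *ₛ (Y ^ₛ n))  ≈⟨ ∙-cong XY≈1 (^ₛ-inverse XY≈1 n) ⟩
    oneₛ *ₛ oneₛ                         ≈⟨ *ₛ-identityˡ oneₛ ⟩
    oneₛ                                 ∎
    where open SetoidReasoning (ℕ →-setoid ℤ)

  fromCount-convolution : ∀ a d → fromCount (λ k → ∑ (suc k) (λ s → a s * d (k ∸ s))) ≗ fromCount a *ₛ fromCount d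
  fromCount-convolution a d k = begin
    ℤ.+ ∑ (suc k) (λ s → a s * d (k ∸ s))                ≡⟨ pos-∑ (suc k) (λ s → a s * d (k ∸ s)) ⟩
    ∑ℤ (suc k) (λ s → ℤ.+ (a s * d (k ∸ s)))             ≡⟨ ∑ℤ-cong (suc k) (λ s _ → ℤP.pos-* (a s) (d (k ∸ s))) ⟩
    ∑ℤ (suc k) (λ s → fromCount a s ℤ.* fromCount d (k ∸ s)) ≡⟨ *ₛ-convolution (fromCount a) (fromCount d) k ⟨
    (fromCount a *ₛ fromCount d) k                        ∎
    where
    open ≡-Reasoning
    pos-∑ : ∀ n f → ℤ.+ ∑ n f ≡ ∑ℤ n (λ i → ℤ.+ f i)
    pos-∑ zero    f = refl
    pos-∑ (suc n) f = trans (ℤP.pos-+ (f 0) _) (cong (λ x → ℤ.+ f 0 ℤ.+ x) (pos-∑ n (f ∘ suc)))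

open PowerSeries

vecCount-series : ∀ c → fromCount (vecCount c) ≗ ones ^ₛ c
vecCount-series zero    zero    = refl
vecCount-series zero    (suc k) = refl
vecCount-series (suc c) k       = begin
  fromCount (vecCount (suc c)) k                              ≡⟨ cong ℤ.+_ (vecCount-suc c k) ⟩
  fromCount (λ k → ∑[ s < suc k ] (1 * vecCount c (k ∸ s))) k  ≡⟨ fromCount-convolution (λ _ → 1) (vecCount c) k ⟩
  (ones *ₛ fromCount (vecCount c)) k                          ≡⟨ *ₛ-cong {ones} (λ _ → refl) (vecCount-series c) k ⟩
  (ones *ₛ (ones ^ₛ c)) k                                     ∎
  where open ≡-Reasoning

matCount-series : ∀ b c → fromCount (matCount b c) ≗ ones ^ₛ (b * c)
matCount-series zero    c zero    = refl
matCount-series zero    c (suc k) = refl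
matCount-series (suc b) c k       = begin
  fromCount (matCount (suc b) c) k                                           ≡⟨ cong ℤ.+_ (matCount-suc b c k) ⟩
  fromCount (λ k → ∑[ s < suc k ] (vecCount c s * matCount b c (k ∸ s))) k   ≡⟨ fromCount-convolution (vecCount c) (matCount b c) k ⟩
  (fromCount (vecCount c) *ₛ fromCount (matCount b c)) k                     ≡⟨ *ₛ-cong (vecCount-series c) (matCount-series b c) k ⟩
  ((ones ^ₛ c) *ₛ (ones ^ₛ (b * c))) k                                       ≡⟨ ^ₛ-+ ones c (b * c) k ⟨
  (ones ^ₛ (c + b * c)) k                                                    ∎
  where open ≡-Reasoning

Zbc≗ones^bc : ∀ b c → Zbc b c ≗ ones ^ₛ (b * c)
Zbc≗ones^bc b c k = trans (cong ℤ.+_ (ZCount≡matCount b c k)) (matCount-series b c k)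

-- The bijection matches the two events for every vector λ.
theorem8p1 : (b c : ℕ) → 1 ≤ b → 1 ≤ c → (lam : Vec ℕ b) → IsPartition lam →
    ((k : ℕ) → probLPP b c lam k ≡ ((oneMinusQ ^ₛ (b * c)) *ₛ gLam b c lam) k)
    × ((k : ℕ) → gNum b c lam k ≡ (Zbc b c *ₛ ((oneMinusQ ^ₛ (b * c)) *ₛ gLam b c lam)) k)
theorem8p1 b c 1≤b 1≤c lam _ = *ₛ-cong {P} (λ _ → refl) lpp≗g , gNum≗ZPg
  where
  open SetoidReasoning (ℕ →-setoid ℤ)
  P : Series
  P = oneMinusQ ^ₛ (b * c)
  lpp≗g : fromCount (lppCount b c lam) ≗ gLam b c lam
  lpp≗g k = cong ℤ.+_ (lppCount≡gCount b c 1≤b 1≤c lam k)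
  ZP≗1 : Zbc b c *ₛ P ≗ oneₛ
  ZP≗1 = begin
    Zbc b c *ₛ P                ≈⟨ *ₛ-cong {g = P} (Zbc≗ones^bc b c) (λ _ → refl) ⟩
    (ones ^ₛ (b * c)) *ₛ P      ≈⟨ *ₛ-comm (ones ^ₛ (b * c)) P ⟩
    P *ₛ (ones ^ₛ (b * c))      ≈⟨ ^ₛ-inverse oneMinusQ*ones (b * c) ⟩
    oneₛ                        ∎
  gNum≗ZPg : gNum b c lam ≗ Zbc b c *ₛ (P *ₛ gLam b c lam)
  gNum≗ZPg = begin
    gNum b c lam                      ≈⟨ (λ k → cong ℤ.+_ (sym (lppCount≡gNumCount b c 1≤c lam k))) ⟩
    fromCount (lppCount b c lam)      ≈⟨ lpp≗g ⟩
    gLam b c lam                      ≈⟨ *ₛ-identityˡ (gLam b c lam) ⟨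
    oneₛ *ₛ gLam b c lam              ≈⟨ *ₛ-cong {g = gLam b c lam} ZP≗1 (λ _ → refl) ⟨
    (Zbc b c *ₛ P) *ₛ gLam b c lam    ≈⟨ *ₛ-assoc (Zbc b c) P (gLam b c lam) ⟩
    Zbc b c *ₛ (P *ₛ gLam b c lam)    ∎
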